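{- For every $n\in\mathbb{Z}_{\geq 0}$ the following two identities hold, in $\mathbb{Q}[[x,y]]$: \[ \sum_{l=0}^{\infty}\sum_{m=0}^{\infty}\mathscr{B}_{m}^{(-l)}(n)\frac{x^{l}}{l!}\frac{y^{m}}{m!} = \frac{n!\,e^{x+y}}{(e^{x}+e^{y}-e^{x+y})^{n+1}} \] and \[ \sum_{l=0}^{\infty}\sum_{m=0}^{\infty}\mathscr{B}_{m}^{(-l)}(n)\,x^{l}y^{m} = \sum_{j=0}^{\infty} j!\,(j+n)!\,Q_{j}(x)Q_{j}(y), \] where $Q_{j}(X) = \dfrac{X^{j}}{(1-X)(1-2X)\cdots(1-(j+1)X)}$ for $j\in\mathbb{Z}_{\geq 0}$, expanded as a power series in $X$.
   Context: For $k\in\mathbb{Z}$ let $\mathrm{Li}_k(z)=\sum_{m\ge1} z^m/m^k$ (for $k\le 0$ this is a rational function of $z$). The poly-Bernoulli polynomials $B_n^{(k)}(x)$ ($k\in\mathbb{Z}$, $n\ge0$) are defined by $e^{ -xt}\frac{\mathrm{Li}_k(1-e^{ -t})}{1-e^{ -t}}=\sum_{n\ge0}B_n^{(k)}(x)\frac{t^n}{n!}$. The Stirling numbers of the first kind ${n \brack j}$ are defined by ${0\brack 0}=1$, ${n\brack 0}={0\brack m}=0$ for $m,n\neq0$, and ${n+1\brack m}={n\brack m-1}+n{n\brack m}$ for $n\ge0,m\ge1$. For $l,m,n\in\mathbb{Z}_{\ge0}$ set $\mathscr{B}_{m}^{(-l)}(n)=\sum_{j=0}^{n}{n\brack j}B_m^{(-l-j)}(n)$.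 -}

module Defs where

open import Data.Nat as ℕ using (ℕ; zero; suc; _∸_; _!)
open import Data.Nat.Properties using (_!≢0; m^n≢0)
open import Data.Bool using (true; false)
open import Data.Integer as ℤ using (ℤ; +_; -[1+_])
open import Data.Rational using (ℚ; 0ℚ; 1ℚ; _+_; _*_; _-_; -_; _/_)

ι : ℕ → ℚ
ι k = + k / 1

invFact : ℕ → ℚ
invFact k = (+ 1 / (k !)) {{k !≢0}}

_^ℚ_ : ℚ → ℕ → ℚ
q ^ℚ zero  = 1ℚ
q ^ℚ suc p = q * (q ^ℚ p)

-- (a+1)^(-k) for k : ℤ  (the factor 1/(a+1)^k in Li_k)
sucPowNeg : ℕ → ℤ → ℚ
sucPowNeg a (+ p)      = (+ 1 / (suc a ℕ.^ p)) {{nz}}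
  where
  nz : ℕ.NonZero (suc a ℕ.^ p)
  nz = m^n≢0 (suc a) p
sucPowNeg a -[1+ p ]   = ι (suc a) ^ℚ suc p

sumTo : ℕ → (ℕ → ℚ) → ℚ
sumTo zero    f = f 0
sumTo (suc n) f = sumTo n f + f (suc n)

infixl 6 _+₁_ _-₁_
infixl 7 _*₁_ _·₁_
infixr 8 _^₁_
infixr 8 _^ℚ_

PS : Set
PS = ℕ → ℚ

const₁ : ℚ → PS
const₁ c zero    = c
const₁ c (suc _) = 0ℚ

_+₁_ : PS → PS → PS
(f +₁ g) k = f k + g k

_-₁_ : PS → PS → PS
(f -₁ g) k = f k - g k

_·₁_ : ℚ → PS → PS
(c ·₁ f) k = c * f k

_*₁_ : PS → PS → PS
(f *₁ g) k = sumTo k (λ i → f i * g (k ∸ i))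

_^₁_ : PS → ℕ → PS
f ^₁ zero  = const₁ 1ℚ
f ^₁ suc p = f *₁ (f ^₁ p)

shift₁ : ℕ → PS → PS
shift₁ j f k with k ℕ.<ᵇ j
... | true  = 0ℚ
... | false = f (k ∸ j)

-- multiplicative inverse of a series with constant term 1:
-- 1/f = Σ_{r≥0} (1 - f)^r ; the coefficient of X^k only gets
-- contributions from r ≤ k since (1 - f) has zero constant term.
inv₁ : PS → PS
inv₁ f k = sumTo k (λ r → ((const₁ 1ℚ -₁ f) ^₁ r) k)

X₁ : PS
X₁ = shift₁ 1 (const₁ 1ℚ)

expSeries : ℚ → PS
expSeries c k = (c ^ℚ k) * invFact k

-- Poly-Bernoulli polynomials B_n^{(k)}(x), k ∈ ℤ
--   e^{-xt} Li_k(1-e^{-t}) / (1-e^{-t}) = Σ_n B_n^{(k)}(x) t^n / n!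
-- with Li_k(z)/z = Σ_{a≥0} z^a / (a+1)^k, composed with z = 1 - e^{-t}
-- (zero constant term, so coefficient of t^N only needs a ≤ N).

oneMinusExpNeg : PS
oneMinusExpNeg = const₁ 1ℚ -₁ expSeries (- 1ℚ)

LiOverZComposed : ℤ → PS
LiOverZComposed k N =
  sumTo N (λ a → sucPowNeg a k * ((oneMinusExpNeg ^₁ a) N))

polyBernoulliGF : ℤ → ℚ → PS
polyBernoulliGF k x = expSeries (- x) *₁ LiOverZComposed k

polyBernoulli : ℕ → ℤ → ℚ → ℚ
polyBernoulli N k x = ι (N !) * polyBernoulliGF k x N

stirling1 : ℕ → ℕ → ℕ
stirling1 zero    zero    = 1
stirling1 zero    (suc m) = 0
stirling1 (suc n) zero    = 0
stirling1 (suc n) (suc m) = stirling1 n m ℕ.+ n ℕ.* stirling1 n (suc m)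

-- 𝓑_m^{(-l)}(n) = Σ_{j=0}^{n} [n , j] B_m^{(-l-j)}(n)
scrB : ℕ → ℕ → ℕ → ℚ
scrB m l n =
  sumTo n (λ j → ι (stirling1 n j) * polyBernoulli m (ℤ.- (+ (l ℕ.+ j))) (ι n))

-- Formal power series in two variables x, y over ℚ:
-- F l m = coefficient of x^l y^m

infixl 6 _+₂_ _-₂_
infixl 7 _*₂_ _·₂_
infixr 8 _^₂_

PS2 : Set
PS2 = ℕ → ℕ → ℚ

const₂ : ℚ → PS2
const₂ c l m = const₁ c l * const₁ 1ℚ m

_-₂_ : PS2 → PS2 → PS2
(F -₂ G) l m = F l m - G l m

_+₂_ : PS2 → PS2 → PS2
(F +₂ G) l m = F l m + G l m

_·₂_ : ℚ → PS2 → PS2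
(c ·₂ F) l m = c * F l m

_*₂_ : PS2 → PS2 → PS2
(F *₂ G) l m = sumTo l (λ i → sumTo m (λ j → F i j * G (l ∸ i) (m ∸ j)))

_^₂_ : PS2 → ℕ → PS2
F ^₂ zero  = const₂ 1ℚ
F ^₂ suc p = F *₂ (F ^₂ p)

-- inverse of a series with constant term 1: Σ_{r≥0} (1 - F)^r;
-- coefficient of x^l y^m only gets contributions from r ≤ l + m.
inv₂ : PS2 → PS2
inv₂ F l m = sumTo (l ℕ.+ m) (λ r → ((const₂ 1ℚ -₂ F) ^₂ r) l m)

inX : PS → PS2
inX f l m = f l * const₁ 1ℚ m

inY : PS → PS2
inY f l m = const₁ 1ℚ l * f m

tensor : PS → PS → PS2
tensor f g l m = f l * g m

expX expY expXY : PS2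
expX  = inX (expSeries 1ℚ)
expY  = inY (expSeries 1ℚ)
expXY = expX *₂ expY

lhsExp : ℕ → PS2
lhsExp n l m = scrB m l n * invFact l * invFact m

rhsExp : ℕ → PS2
rhsExp n = (ι (n !) ·₂ expXY) *₂ inv₂ ((expX +₂ expY -₂ expXY) ^₂ suc n)

lhsOrd : ℕ → PS2
lhsOrd n l m = scrB m l n

prodOneMinus : ℕ → PS
prodOneMinus zero    = const₁ 1ℚ
prodOneMinus (suc p) = prodOneMinus p *₁ (const₁ 1ℚ -₁ (ι (suc p) ·₁ X₁))

Q : ℕ → PS
Q j = (X₁ ^₁ j) *₁ inv₁ (prodOneMinus (suc j))

-- Σ_{j≥0} j! (j+n)! Q_j(x) Q_j(y); since Q_j(x)Q_j(y) has total order ≥ 2j,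
-- the coefficient of x^l y^m only gets contributions from j ≤ l + m.
rhsOrd : ℕ → PS2
rhsOrd n l m =
  sumTo (l ℕ.+ m) (λ j → ι (j ! ℕ.* (j ℕ.+ n) !) * tensor (Q j) (Q j) l m)

-- Since Li_{-k}(z)/z = Σ_a (a+1)^k z^a, the Stirling sum defining 𝓑 turns (a+1)^{l+j} into
-- (a+1)^l (a+1)(a+2)⋯(a+n).  Expanding (a+1)^l in falling factorials of a with Stirling
-- numbers of the second kind, and using Σ_b (b+1)(b+2)⋯(b+K) u^b = K!/(1-u)^{K+1} for
-- u = 1 - e^{-t} together with (e^t - 1)^i e^t = Σ_m i! S(m+1,i+1) t^m/m!, gives
--   𝓑_m^{(-l)}(n) = Σ_i i! (i+n)! S(l+1,i+1) S(m+1,i+1).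
-- The ordinary generating function then follows from Σ_m S(m+1,j+1) X^m = Q_j(X); the
-- exponential one from the same rising-factorial identity for U = (e^x - 1)(e^y - 1),
-- since 1 - U = e^x + e^y - e^{x+y}.
module Submission where

open import Defs
open import Data.Nat using (ℕ)
open import Data.Product using (_×_; _,_)
open import Relation.Binary.PropositionalEquality using (_≡_)
open import Algebra using (CommutativeRing)

module NatCombinatorics where
  open import Data.Nat
  open import Data.Nat.Properties
  open import Relation.Binary.PropositionalEquality
  open import Relation.Nullary using (yes; no)
  open import Data.Sum using (inj₁; inj₂)
  open import Data.Nat.Solver using (module +-*-Solver)
  open +-*-Solver
  open ≡-Reasoning

  rising : ℕ → ℕ → ℕ
  rising x zero    = 1
  rising x (suc K) = rising x K * (x + K)

  falling : ℕ → ℕ → ℕ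
  falling a zero    = 1
  falling a (suc i) = falling a i * (a ∸ i)

  -- stirling2⁺ m i is the Stirling number of the second kind S(m+1, i+1).
  stirling2⁺ : ℕ → ℕ → ℕ
  stirling2⁺ zero    zero    = 1
  stirling2⁺ zero    (suc i) = 0
  stirling2⁺ (suc m) zero    = stirling2⁺ m zero
  stirling2⁺ (suc m) (suc i) = stirling2⁺ m i + suc (suc i) * stirling2⁺ m (suc i)

  rising-suc : ∀ x K → rising x (suc K) ≡ x * rising (suc x) K
  rising-suc x zero = solve 1 (λ x → con 1 :* (x :+ con 0) := x :* con 1) refl x
  rising-suc x (suc K) = begin
    rising x (suc K) * (x + suc K)      ≡⟨ cong (_* (x + suc K)) (rising-suc x K) ⟩
    x * rising (suc x) K * (x + suc K)
      ≡⟨ solve 3 (λ x r K → x :* r :* (x :+ (con 1 :+ K)) := x :* (r :* (con 1 :+ x :+ K))) refl x (rising (suc x) K) K ⟩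
    x * (rising (suc x) K * (suc x + K)) ∎

  rising-+ : ∀ x i n → rising x (i + n) ≡ rising x i * rising (x + i) n
  rising-+ x i zero = trans (cong (rising x) (+-identityʳ i)) (sym (*-identityʳ (rising x i)))
  rising-+ x i (suc n) = begin
    rising x (i + suc n)                      ≡⟨ cong (rising x) (+-suc i n) ⟩
    rising x (i + n) * (x + (i + n))          ≡⟨ cong₂ _*_ (rising-+ x i n) (sym (+-assoc x i n)) ⟩
    rising x i * rising (x + i) n * (x + i + n) ≡⟨ *-assoc (rising x i) _ _ ⟩
    rising x i * (rising (x + i) n * (x + i + n)) ∎

  rising-1 : ∀ K → rising 1 K ≡ K !
  rising-1 zero = refl
  rising-1 (suc K) = trans (cong (_* suc K) (rising-1 K)) (*-comm (K !) (suc K))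

  !-split : ∀ i n → (i + n) ! ≡ i ! * rising (suc i) n
  !-split i n = begin
    (i + n) !                      ≡⟨ sym (rising-1 (i + n)) ⟩
    rising 1 (i + n)               ≡⟨ rising-+ 1 i n ⟩
    rising 1 i * rising (suc i) n  ≡⟨ cong (_* rising (suc i) n) (rising-1 i) ⟩
    i ! * rising (suc i) n         ∎

  rising-pascal : ∀ b K → rising (2 + b) (suc K) ≡ suc K * rising (2 + b) K + rising (suc b) (suc K)
  rising-pascal b K = begin
    rising (2 + b) K * (2 + b + K)
      ≡⟨ solve 3 (λ r b K → r :* (con 2 :+ b :+ K) := (con 1 :+ K) :* r :+ (con 1 :+ b) :* r) refl (rising (2 + b) K) b K ⟩
    suc K * rising (2 + b) K + suc b * rising (2 + b) K
      ≡⟨ cong (suc K * rising (2 + b) K +_) (sym (rising-suc (suc b) K)) ⟩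
    suc K * rising (2 + b) K + rising (suc b) (suc K) ∎

  falling-vanishes : ∀ a i → a < i → falling a i ≡ 0
  falling-vanishes a (suc i) (s≤s a≤i) with m≤n⇒m<n∨m≡n a≤i
  ... | inj₁ a<i = cong (_* (a ∸ i)) (falling-vanishes a i a<i)
  ... | inj₂ refl = trans (cong (falling a a *_) (n∸n≡0 a)) (*-zeroʳ (falling a a))

  suc*falling : ∀ a i → suc a * falling a i ≡ falling a (suc i) + suc i * falling a i
  suc*falling a i with i ≤? a
  ... | yes i≤a = begin
    suc a * falling a i           ≡⟨ cong (λ v → suc v * falling a i) (sym (m∸n+n≡m i≤a)) ⟩
    suc (a ∸ i + i) * falling a i ≡⟨ solve 3 (λ d i f → (con 1 :+ (d :+ i)) :* f := f :* d :+ (con 1 :+ i) :* f) refl (a ∸ i) i (falling a i) ⟩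
    falling a i * (a ∸ i) + suc i * falling a i ∎
  ... | no i≰a rewrite falling-vanishes a i (≰⇒> i≰a) =
    trans (*-zeroʳ (suc a)) (sym (trans (cong (_+ suc i * 0) (*-zeroˡ (a ∸ i))) (*-zeroʳ (suc i))))

  falling≡rising : ∀ b i → falling (b + i) i ≡ rising (suc b) i
  falling≡rising b zero = refl
  falling≡rising b (suc i) = begin
    falling (b + suc i) i * (b + suc i ∸ i) ≡⟨ cong₂ (λ u v → falling u i * v) (+-suc b i) b+1+i∸i≡1+b ⟩
    falling (suc b + i) i * suc b          ≡⟨ cong (_* suc b) (falling≡rising (suc b) i) ⟩
    rising (2 + b) i * suc b               ≡⟨ *-comm _ (suc b) ⟩
    suc b * rising (2 + b) i               ≡⟨ sym (rising-suc (suc b) i) ⟩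
    rising (suc b) (suc i)                 ∎
    where
    b+1+i∸i≡1+b : b + suc i ∸ i ≡ suc b
    b+1+i∸i≡1+b = trans (cong (_∸ i) (+-suc b i)) (trans (+-∸-assoc 1 (m≤n+m i b)) (cong suc (m+n∸n≡m b i)))

  falling*rising : ∀ b i n → falling (b + i) i * rising (suc (b + i)) n ≡ rising (suc b) (i + n)
  falling*rising b i n = begin
    falling (b + i) i * rising (suc (b + i)) n ≡⟨ cong (_* rising (suc (b + i)) n) (falling≡rising b i) ⟩
    rising (suc b) i * rising (suc b + i) n    ≡⟨ sym (rising-+ (suc b) i n) ⟩
    rising (suc b) (i + n)                     ∎

  stirling2⁺-vanishes : ∀ m i → m < i → stirling2⁺ m i ≡ 0
  stirling2⁺-vanishes zero (suc i) _ = refl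
  stirling2⁺-vanishes (suc m) (suc i) (s≤s m<i)
    rewrite stirling2⁺-vanishes m i m<i | stirling2⁺-vanishes m (suc i) (m≤n⇒m≤1+n m<i) = *-zeroʳ i

  stirling1-vanishes : ∀ n j → n < j → stirling1 n j ≡ 0
  stirling1-vanishes zero (suc j) _ = refl
  stirling1-vanishes (suc n) (suc j) (s≤s n<j)
    rewrite stirling1-vanishes n j n<j | stirling1-vanishes n (suc j) (m≤n⇒m≤1+n n<j) = *-zeroʳ n

module FiniteSums {c ℓ} (R : CommutativeRing c ℓ) where
  open CommutativeRing R
  open import Data.Nat as ℕ using (ℕ; zero; suc; _∸_; _≤_; _<_; z≤n; s≤s)
  import Data.Nat.Properties as ℕP
  import Relation.Binary.PropositionalEquality as P
  open import Relation.Binary.Reasoning.Setoid setoid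
  open import Algebra.Properties.Ring ring using (-‿distribˡ-*; -‿distribʳ-*; ⁻¹-anti-homo‿-)
  open import Algebra.Properties.CommutativeSemiring.Exp commutativeSemiring public
    using (_^_; ^-congˡ; ^-homo-*; ^-distrib-*)
  import Algebra.Properties.Semiring.Mult semiring as Mult
  open import Algebra.Properties.CommutativeSemigroup +-commutativeSemigroup using (interchange)

  Σ : ℕ → (ℕ → Carrier) → Carrier
  Σ zero    f = f 0
  Σ (suc n) f = Σ n f + f (suc n)

  fromℕ : ℕ → Carrier
  fromℕ k = k Mult.× 1#

  fromℕ-+ : ∀ m n → fromℕ (m ℕ.+ n) ≈ fromℕ m + fromℕ n
  fromℕ-+ = Mult.×-homo-+ 1#

  fromℕ-* : ∀ m n → fromℕ (m ℕ.* n) ≈ fromℕ m * fromℕ n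
  fromℕ-* = Mult.×1-homo-*

  fromℕ-^ : ∀ m n → fromℕ (m ℕ.^ n) ≈ fromℕ m ^ n
  fromℕ-^ m zero = +-identityʳ 1#
  fromℕ-^ m (suc n) = trans (fromℕ-* m (m ℕ.^ n)) (*-congˡ (fromℕ-^ m n))

  1^n≈1 : ∀ n → 1# ^ n ≈ 1#
  1^n≈1 zero    = refl
  1^n≈1 (suc n) = trans (*-identityˡ _) (1^n≈1 n)

  cong≈ : (f : ℕ → Carrier) → ∀ {i j} → i P.≡ j → f i ≈ f j
  cong≈ f eq = reflexive (P.cong f eq)

  Σ-cong≤ : ∀ n {f g} → (∀ i → i ≤ n → f i ≈ g i) → Σ n f ≈ Σ n g
  Σ-cong≤ zero h = h 0 z≤n
  Σ-cong≤ (suc n) h = +-cong (Σ-cong≤ n (λ i i≤n → h i (ℕP.m≤n⇒m≤1+n i≤n))) (h (suc n) ℕP.≤-refl)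

  Σ-cong : ∀ n {f g} → (∀ i → f i ≈ g i) → Σ n f ≈ Σ n g
  Σ-cong n h = Σ-cong≤ n (λ i _ → h i)

  Σ-congˡ : ∀ {n m} f → n P.≡ m → Σ n f ≈ Σ m f
  Σ-congˡ f P.refl = refl

  Σ-+ : ∀ n (f g : ℕ → Carrier) → Σ n (λ i → f i + g i) ≈ Σ n f + Σ n g
  Σ-+ zero f g = refl
  Σ-+ (suc n) f g = begin
    Σ n (λ i → f i + g i) + (f (suc n) + g (suc n)) ≈⟨ +-congʳ (Σ-+ n f g) ⟩
    (Σ n f + Σ n g) + (f (suc n) + g (suc n))       ≈⟨ interchange _ _ _ _ ⟩
    (Σ n f + f (suc n)) + (Σ n g + g (suc n))       ∎

  Σ-*ˡ : ∀ n a (f : ℕ → Carrier) → a * Σ n f ≈ Σ n (λ i → a * f i)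
  Σ-*ˡ zero a f = refl
  Σ-*ˡ (suc n) a f = trans (distribˡ a (Σ n f) (f (suc n))) (+-congʳ (Σ-*ˡ n a f))

  Σ-*ʳ : ∀ n a (f : ℕ → Carrier) → Σ n f * a ≈ Σ n (λ i → f i * a)
  Σ-*ʳ n a f = trans (*-comm _ a) (trans (Σ-*ˡ n a f) (Σ-cong n (λ i → *-comm a (f i))))

  Σ-zero : ∀ n (f : ℕ → Carrier) → (∀ i → i ≤ n → f i ≈ 0#) → Σ n f ≈ 0#
  Σ-zero zero f h = h 0 z≤n
  Σ-zero (suc n) f h =
    trans (+-cong (Σ-zero n f (λ i i≤n → h i (ℕP.m≤n⇒m≤1+n i≤n))) (h (suc n) ℕP.≤-refl)) (+-identityˡ 0#)

  Σ-unfoldˡ : ∀ n (f : ℕ → Carrier) → Σ (suc n) f ≈ f 0 + Σ n (λ i → f (suc i))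
  Σ-unfoldˡ zero f = refl
  Σ-unfoldˡ (suc n) f = trans (+-congʳ (Σ-unfoldˡ n f)) (+-assoc _ _ _)

  Σ-extend : ∀ n k (f : ℕ → Carrier) → (∀ i → n < i → f i ≈ 0#) → Σ (n ℕ.+ k) f ≈ Σ n f
  Σ-extend n zero f h = Σ-congˡ f (ℕP.+-identityʳ n)
  Σ-extend n (suc k) f h = begin
    Σ (n ℕ.+ suc k) f                 ≈⟨ Σ-congˡ f (ℕP.+-suc n k) ⟩
    Σ (n ℕ.+ k) f + f (suc (n ℕ.+ k)) ≈⟨ +-cong (Σ-extend n k f h) (h _ (s≤s (ℕP.m≤m+n n k))) ⟩
    Σ n f + 0#                        ≈⟨ +-identityʳ _ ⟩
    Σ n f                             ∎

  Σ-extend≤ : ∀ {n m} f → n ≤ m → (∀ i → n < i → f i ≈ 0#) → Σ m f ≈ Σ n f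
  Σ-extend≤ {n} {m} f n≤m h = trans (Σ-congˡ f (P.sym (ℕP.m+[n∸m]≡n n≤m))) (Σ-extend n (m ∸ n) f h)

  Σ-shift : ∀ s n f → (∀ j → j < s → f j ≈ 0#) → Σ (n ℕ.+ s) f ≈ Σ n (λ b → f (b ℕ.+ s))
  Σ-shift zero n f z = trans (Σ-congˡ f (ℕP.+-identityʳ n)) (Σ-cong n (λ b → cong≈ f (P.sym (ℕP.+-identityʳ b))))
  Σ-shift (suc s) n f z = begin
    Σ (n ℕ.+ suc s) f                       ≈⟨ Σ-congˡ f (ℕP.+-suc n s) ⟩
    Σ (suc (n ℕ.+ s)) f                     ≈⟨ Σ-unfoldˡ _ f ⟩
    f 0 + Σ (n ℕ.+ s) (λ i → f (suc i))     ≈⟨ +-cong (z 0 (s≤s z≤n)) (Σ-shift s n (λ i → f (suc i)) (λ j lt → z (suc j) (s≤s lt))) ⟩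
    0# + Σ n (λ b → f (suc (b ℕ.+ s)))      ≈⟨ +-identityˡ _ ⟩
    Σ n (λ b → f (suc (b ℕ.+ s)))           ≈⟨ Σ-cong n (λ b → cong≈ f (P.sym (ℕP.+-suc b s))) ⟩
    Σ n (λ b → f (b ℕ.+ suc s))             ∎

  Σ-swap : ∀ n m (F : ℕ → ℕ → Carrier) → Σ n (λ i → Σ m (λ j → F i j)) ≈ Σ m (λ j → Σ n (λ i → F i j))
  Σ-swap zero m F = refl
  Σ-swap (suc n) m F = begin
    Σ n (λ i → Σ m (λ j → F i j)) + Σ m (λ j → F (suc n) j) ≈⟨ +-congʳ (Σ-swap n m F) ⟩
    Σ m (λ j → Σ n (λ i → F i j)) + Σ m (λ j → F (suc n) j) ≈⟨ sym (Σ-+ m _ _) ⟩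
    Σ m (λ j → Σ n (λ i → F i j) + F (suc n) j)             ∎

  Σ-triangle : ∀ k (G : ℕ → ℕ → Carrier) →
               Σ k (λ i → Σ i (λ a → G a i)) ≈ Σ k (λ a → Σ (k ∸ a) (λ b → G a (a ℕ.+ b)))
  Σ-triangle zero G = refl
  Σ-triangle (suc k) G = begin
    Σ k (λ i → Σ i (λ a → G a i)) + Σ (suc k) (λ a → G a (suc k))
       ≈⟨ +-congʳ (Σ-triangle k G) ⟩
    Σ k (λ a → Σ (k ∸ a) (λ b → G a (a ℕ.+ b))) + (Σ k (λ a → G a (suc k)) + G (suc k) (suc k))
       ≈⟨ sym (+-assoc _ _ _) ⟩
    (Σ k (λ a → Σ (k ∸ a) (λ b → G a (a ℕ.+ b))) + Σ k (λ a → G a (suc k))) + G (suc k) (suc k)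
       ≈⟨ +-cong (sym (Σ-+ k _ _)) (cong≈ (G (suc k)) (P.sym (ℕP.+-identityʳ (suc k)))) ⟩
    Σ k (λ a → Σ (k ∸ a) (λ b → G a (a ℕ.+ b)) + G a (suc k)) + G (suc k) (suc k ℕ.+ 0)
       ≈⟨ +-cong (Σ-cong≤ k row) (Σ-congˡ (λ b → G (suc k) (suc k ℕ.+ b)) (P.sym (ℕP.n∸n≡0 k))) ⟩
    Σ k (λ a → Σ (suc k ∸ a) (λ b → G a (a ℕ.+ b))) + Σ (suc k ∸ suc k) (λ b → G (suc k) (suc k ℕ.+ b)) ∎
    where
    row : ∀ a → a ≤ k → Σ (k ∸ a) (λ b → G a (a ℕ.+ b)) + G a (suc k) ≈ Σ (suc k ∸ a) (λ b → G a (a ℕ.+ b))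
    row a a≤k = begin
      Σ (k ∸ a) (λ b → G a (a ℕ.+ b)) + G a (suc k) ≈⟨ +-congˡ (cong≈ (G a) (P.sym a+[1+k∸a]≡1+k)) ⟩
      Σ (suc (k ∸ a)) (λ b → G a (a ℕ.+ b))         ≈⟨ Σ-congˡ _ (P.sym (ℕP.+-∸-assoc 1 a≤k)) ⟩
      Σ (suc k ∸ a) (λ b → G a (a ℕ.+ b))           ∎
      where
      a+[1+k∸a]≡1+k : a ℕ.+ suc (k ∸ a) P.≡ suc k
      a+[1+k∸a]≡1+k = P.trans (ℕP.+-suc a (k ∸ a)) (P.cong suc (ℕP.m+[n∸m]≡n a≤k))

  Σ-reverse : ∀ k (f : ℕ → Carrier) → Σ k f ≈ Σ k (λ i → f (k ∸ i))
  Σ-reverse zero f = refl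
  Σ-reverse (suc k) f = begin
    Σ k f + f (suc k)                 ≈⟨ +-congʳ (Σ-reverse k f) ⟩
    Σ k (λ i → f (k ∸ i)) + f (suc k) ≈⟨ +-comm _ _ ⟩
    f (suc k) + Σ k (λ i → f (k ∸ i)) ≈⟨ sym (Σ-unfoldˡ k _) ⟩
    Σ (suc k) (λ i → f (suc k ∸ i))   ∎

  Σ-recurrence : ∀ N (t A : ℕ → Carrier) u → t 0 ≈ A 0 → (∀ b → t (suc b) ≈ A (suc b) + u * t b) →
                 Σ (suc N) t ≈ Σ (suc N) A + u * Σ N t
  Σ-recurrence N t A u t0 tsuc = begin
    Σ (suc N) t                                           ≈⟨ Σ-unfoldˡ N t ⟩
    t 0 + Σ N (λ b → t (suc b))                           ≈⟨ +-cong t0 (Σ-cong N tsuc) ⟩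
    A 0 + Σ N (λ b → A (suc b) + u * t b)                 ≈⟨ +-congˡ (Σ-+ N _ _) ⟩
    A 0 + (Σ N (λ b → A (suc b)) + Σ N (λ b → u * t b))   ≈⟨ sym (+-assoc _ _ _) ⟩
    (A 0 + Σ N (λ b → A (suc b))) + Σ N (λ b → u * t b)   ≈⟨ +-cong (sym (Σ-unfoldˡ N A)) (sym (Σ-*ˡ N u t)) ⟩
    Σ (suc N) A + u * Σ N t                               ∎

  geometric-sum : ∀ h N → Σ N (h ^_) + h ^ suc N ≈ 1# + h * Σ N (h ^_)
  geometric-sum h zero = +-congˡ (*-congˡ refl)
  geometric-sum h (suc N) = begin
    (Σ N (h ^_) + h ^ suc N) + h ^ suc (suc N)   ≈⟨ +-congʳ (geometric-sum h N) ⟩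
    (1# + h * Σ N (h ^_)) + h * h ^ suc N        ≈⟨ +-assoc _ _ _ ⟩
    1# + (h * Σ N (h ^_) + h * h ^ suc N)        ≈⟨ +-congˡ (sym (distribˡ h _ _)) ⟩
    1# + h * (Σ N (h ^_) + h ^ suc N)            ∎

  geometric-inverse : ∀ f N → f * Σ N ((1# - f) ^_) + (1# - f) ^ suc N ≈ 1#
  geometric-inverse f N = begin
    f * S + H                ≈⟨ +-congʳ (*-congʳ f≈1-h) ⟩
    (1# - h) * S + H         ≈⟨ +-congʳ (distribʳ S 1# (- h)) ⟩
    (1# * S + - h * S) + H   ≈⟨ +-congʳ (+-cong (*-identityˡ S) (sym (-‿distribˡ-* h S))) ⟩
    (S - h * S) + H          ≈⟨ +-assoc _ _ _ ⟩
    S + (- (h * S) + H)      ≈⟨ +-congˡ (+-comm _ _) ⟩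
    S + (H - h * S)          ≈⟨ sym (+-assoc _ _ _) ⟩
    (S + H) - h * S          ≈⟨ +-congʳ (geometric-sum h N) ⟩
    (1# + h * S) - h * S     ≈⟨ +-assoc _ _ _ ⟩
    1# + (h * S - h * S)     ≈⟨ +-congˡ (-‿inverseʳ _) ⟩
    1# + 0#                  ≈⟨ +-identityʳ _ ⟩
    1#                       ∎
    where
    h S H : Carrier
    h = 1# - f
    S = Σ N (h ^_)
    H = h ^ suc N
    f≈1-h : f ≈ 1# - h
    f≈1-h = sym (begin
      1# - (1# - f)       ≈⟨ +-congˡ (⁻¹-anti-homo‿- 1# f) ⟩
      1# + (f - 1#)       ≈⟨ +-comm _ _ ⟩
      (f - 1#) + 1#       ≈⟨ +-assoc _ _ _ ⟩
      f + (- 1# + 1#)     ≈⟨ +-congˡ (-‿inverseˡ 1#) ⟩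
      f + 0#              ≈⟨ +-identityʳ f ⟩
      f                   ∎)

  fixpoint*[1-u] : ∀ x a u → x ≈ a + u * x → x * (1# - u) ≈ a
  fixpoint*[1-u] x a u e = begin
    x * (1# - u)           ≈⟨ distribˡ x 1# (- u) ⟩
    x * 1# + x * - u       ≈⟨ +-cong (*-identityʳ x) (sym (-‿distribʳ-* x u)) ⟩
    x - x * u              ≈⟨ +-congʳ e ⟩
    (a + u * x) - x * u    ≈⟨ +-assoc _ _ _ ⟩
    a + (u * x - x * u)    ≈⟨ +-congˡ (+-congʳ (*-comm u x)) ⟩
    a + (x * u - x * u)    ≈⟨ +-congˡ (-‿inverseʳ _) ⟩
    a + 0#                 ≈⟨ +-identityʳ a ⟩
    a                      ∎

module PowerSeries {c ℓ} (R : CommutativeRing c ℓ) where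
  open CommutativeRing R
  open FiniteSums R public
  open import Data.Nat as ℕ using (ℕ; zero; suc; _∸_; _≤_; _<_; s≤s)
  import Data.Nat.Properties as ℕP
  import Relation.Binary.Reasoning.Setoid as SetoidReasoning
  open SetoidReasoning setoid
  import Relation.Binary.PropositionalEquality as P
  open import Relation.Nullary using (yes; no)
  open import Algebra.Structures using (IsCommutativeRing)
  import Algebra.Solver.Ring.NaturalCoefficients.Default as NaturalCoefficients
  import Algebra.Properties.CommutativeSemigroup as CommutativeSemigroupProperties

  PSer : Set c
  PSer = ℕ → Carrier

  infix 4 _≈ₚ_
  _≈ₚ_ : PSer → PSer → Set ℓ
  f ≈ₚ g = ∀ k → f k ≈ g k

  0ₚ : PSer
  0ₚ k = 0#

  κ : Carrier → PSer
  κ a zero    = a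
  κ a (suc k) = 0#

  1ₚ : PSer
  1ₚ = κ 1#

  infixl 6 _+ₚ_
  infixl 7 _*ₚ_

  _+ₚ_ : PSer → PSer → PSer
  (f +ₚ g) k = f k + g k

  -ₚ_ : PSer → PSer
  (-ₚ f) k = - f k

  _*ₚ_ : PSer → PSer → PSer
  (f *ₚ g) k = Σ k (λ i → f i * g (k ∸ i))

  *ₚ-cong : ∀ {f f' g g'} → f ≈ₚ f' → g ≈ₚ g' → f *ₚ g ≈ₚ f' *ₚ g'
  *ₚ-cong ef eg k = Σ-cong k (λ i → *-cong (ef i) (eg (k ∸ i)))

  *ₚ-comm : ∀ f g → f *ₚ g ≈ₚ g *ₚ f
  *ₚ-comm f g k = begin
    Σ k (λ i → f i * g (k ∸ i))             ≈⟨ Σ-reverse k _ ⟩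
    Σ k (λ i → f (k ∸ i) * g (k ∸ (k ∸ i))) ≈⟨ Σ-cong≤ k (λ i i≤k → trans (*-comm _ _) (*-congʳ (cong≈ g (ℕP.m∸[m∸n]≡n i≤k)))) ⟩
    Σ k (λ i → g i * f (k ∸ i))             ∎

  *ₚ-assoc : ∀ f g h → (f *ₚ g) *ₚ h ≈ₚ f *ₚ (g *ₚ h)
  *ₚ-assoc f g h k = begin
    Σ k (λ i → Σ i (λ a → f a * g (i ∸ a)) * h (k ∸ i))
      ≈⟨ Σ-cong k (λ i → Σ-*ʳ i _ _) ⟩
    Σ k (λ i → Σ i (λ a → f a * g (i ∸ a) * h (k ∸ i)))
      ≈⟨ Σ-triangle k _ ⟩
    Σ k (λ a → Σ (k ∸ a) (λ b → f a * g ((a ℕ.+ b) ∸ a) * h (k ∸ (a ℕ.+ b))))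
      ≈⟨ Σ-cong k (λ a → Σ-cong (k ∸ a) (λ b → trans (*-assoc _ _ _)
           (*-congˡ (*-cong (cong≈ g (ℕP.m+n∸m≡n a b)) (cong≈ h (P.sym (ℕP.∸-+-assoc k a b))))))) ⟩
    Σ k (λ a → Σ (k ∸ a) (λ b → f a * (g b * h ((k ∸ a) ∸ b))))
      ≈⟨ Σ-cong k (λ a → sym (Σ-*ˡ (k ∸ a) _ _)) ⟩
    Σ k (λ a → f a * Σ (k ∸ a) (λ b → g b * h ((k ∸ a) ∸ b))) ∎

  *ₚ-distribˡ : ∀ f g h → f *ₚ (g +ₚ h) ≈ₚ f *ₚ g +ₚ f *ₚ h
  *ₚ-distribˡ f g h k = trans (Σ-cong k (λ i → distribˡ _ _ _)) (Σ-+ k _ _)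

  κ-*ₚ : ∀ a f k → (κ a *ₚ f) k ≈ a * f k
  κ-*ₚ a f zero = refl
  κ-*ₚ a f (suc k) = begin
    Σ (suc k) (λ i → κ a i * f (suc k ∸ i))    ≈⟨ Σ-unfoldˡ k _ ⟩
    a * f (suc k) + Σ k (λ i → 0# * f (k ∸ i)) ≈⟨ +-congˡ (Σ-zero k _ (λ i _ → zeroˡ _)) ⟩
    a * f (suc k) + 0#                         ≈⟨ +-identityʳ _ ⟩
    a * f (suc k)                              ∎

  *ₚ-identityˡ : ∀ f → 1ₚ *ₚ f ≈ₚ f
  *ₚ-identityˡ f k = trans (κ-*ₚ 1# f k) (*-identityˡ (f k))

  isCommutativeRingₚ : IsCommutativeRing _≈ₚ_ _+ₚ_ _*ₚ_ -ₚ_ 0ₚ 1ₚ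
  isCommutativeRingₚ = record
    { isRing = record
      { +-isAbelianGroup = record
        { isGroup = record
          { isMonoid = record
            { isSemigroup = record
              { isMagma = record
                { isEquivalence = record
                  { refl = λ k → refl ; sym = λ e k → sym (e k) ; trans = λ e e' k → trans (e k) (e' k) }
                ; ∙-cong = λ e e' k → +-cong (e k) (e' k) }
              ; assoc = λ f g h k → +-assoc (f k) (g k) (h k) }
            ; identity = (λ f k → +-identityˡ (f k)) , (λ f k → +-identityʳ (f k)) }
          ; inverse = (λ f k → -‿inverseˡ (f k)) , (λ f k → -‿inverseʳ (f k))
          ; ⁻¹-cong = λ e k → -‿cong (e k) }
        ; comm = λ f g k → +-comm (f k) (g k) }
      ; *-cong = *ₚ-cong
      ; *-assoc = *ₚ-assoc
      ; *-identity = *ₚ-identityˡ , (λ f k → trans (*ₚ-comm f 1ₚ k) (*ₚ-identityˡ f k))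
      ; distrib = *ₚ-distribˡ , (λ f g h k → trans (*ₚ-comm (g +ₚ h) f k)
                    (trans (*ₚ-distribˡ f g h k) (+-cong (*ₚ-comm f g k) (*ₚ-comm f h k)))) }
    ; *-comm = *ₚ-comm }

  commutativeRingₚ : CommutativeRing c ℓ
  commutativeRingₚ = record { isCommutativeRing = isCommutativeRingₚ }

  module Ser = FiniteSums commutativeRingₚ
  module SerR = CommutativeRing commutativeRingₚ
  module SerReasoning = SetoidReasoning SerR.setoid
  module SerSolver = NaturalCoefficients SerR.commutativeSemiring
  module SerComm = CommutativeSemigroupProperties SerR.*-commutativeSemigroup

  *ₚ-congˡ : ∀ x {y z} → y ≈ₚ z → x *ₚ y ≈ₚ x *ₚ z
  *ₚ-congˡ x = *ₚ-cong {x} {x} (λ k → refl)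

  *ₚ-congʳ : ∀ x {y z} → y ≈ₚ z → y *ₚ x ≈ₚ z *ₚ x
  *ₚ-congʳ x e = *ₚ-cong {g = x} {g' = x} e (λ k → refl)

  κ-cong : ∀ {a b} → a ≈ b → κ a ≈ₚ κ b
  κ-cong e zero    = e
  κ-cong e (suc k) = refl

  κ-* : ∀ a b → κ a *ₚ κ b ≈ₚ κ (a * b)
  κ-* a b zero    = refl
  κ-* a b (suc k) = trans (κ-*ₚ a (κ b) (suc k)) (zeroʳ a)

  κ-+ : ∀ a b → κ a +ₚ κ b ≈ₚ κ (a + b)
  κ-+ a b zero    = refl
  κ-+ a b (suc k) = +-identityʳ 0#

  κ-Σ : ∀ n (f : ℕ → Carrier) → Ser.Σ n (λ j → κ (f j)) ≈ₚ κ (Σ n f)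
  κ-Σ zero    f k = refl
  κ-Σ (suc n) f k = trans (+-congʳ (κ-Σ n f k)) (κ-+ (Σ n f) (f (suc n)) k)

  Σ-κ*κ* : ∀ N (a b : ℕ → Carrier) w → Ser.Σ N (λ j → κ (a j) *ₚ (κ (b j) *ₚ w)) ≈ₚ κ (Σ N (λ j → a j * b j)) *ₚ w
  Σ-κ*κ* N a b w = SerReasoning.begin
    Ser.Σ N (λ j → κ (a j) *ₚ (κ (b j) *ₚ w))
      SerReasoning.≈⟨ Ser.Σ-cong N (λ j → SerR.trans (SerR.sym (SerR.*-assoc (κ (a j)) (κ (b j)) w)) (*ₚ-congʳ w (κ-* (a j) (b j)))) ⟩
    Ser.Σ N (λ j → κ (a j * b j) *ₚ w)   SerReasoning.≈⟨ SerR.sym (Ser.Σ-*ʳ N w _) ⟩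
    Ser.Σ N (λ j → κ (a j * b j)) *ₚ w   SerReasoning.≈⟨ *ₚ-congʳ w (κ-Σ N _) ⟩
    κ (Σ N (λ j → a j * b j)) *ₚ w       SerReasoning.∎

  κ-fromℕ-* : ∀ m n → κ (fromℕ (m ℕ.* n)) ≈ₚ κ (fromℕ m) *ₚ κ (fromℕ n)
  κ-fromℕ-* m n k = sym (trans (κ-* (fromℕ m) (fromℕ n) k) (κ-cong (sym (fromℕ-* m n)) k))

  κ-fromℕ-+ : ∀ m n → κ (fromℕ (m ℕ.+ n)) ≈ₚ κ (fromℕ m) +ₚ κ (fromℕ n)
  κ-fromℕ-+ m n k = sym (trans (κ-+ (fromℕ m) (fromℕ n) k) (κ-cong (sym (fromℕ-+ m n)) k))

  Σ-coeff : ∀ N (F : ℕ → PSer) k → Ser.Σ N F k ≈ Σ N (λ j → F j k)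
  Σ-coeff zero    F k = refl
  Σ-coeff (suc N) F k = +-congʳ (Σ-coeff N F k)

  Order≥ : ℕ → PSer → Set ℓ
  Order≥ d f = ∀ k → k < d → f k ≈ 0#

  Order≥-* : ∀ a b f g → Order≥ a f → Order≥ b g → Order≥ (a ℕ.+ b) (f *ₚ g)
  Order≥-* a b f g of og k k<a+b = Σ-zero k _ term
    where
    term : ∀ i → i ≤ k → f i * g (k ∸ i) ≈ 0#
    term i i≤k with i ℕP.<? a
    ... | yes i<a = trans (*-congʳ (of i i<a)) (zeroˡ _)
    ... | no i≮a = trans (*-congˡ (og (k ∸ i) k∸i<b)) (zeroʳ _)
      where
      k∸i<b : k ∸ i < b
      k∸i<b = P.subst (k ∸ i <_) (ℕP.m+n∸m≡n i b)
                (ℕP.∸-monoˡ-< (ℕP.<-≤-trans k<a+b (ℕP.+-monoˡ-≤ b (ℕP.≮⇒≥ i≮a))) i≤k)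

  Order≥-0 : ∀ f → Order≥ 0 f
  Order≥-0 f k ()

  Order≥-*ˡ : ∀ b g f → Order≥ b f → Order≥ b (g *ₚ f)
  Order≥-*ˡ b g f = Order≥-* 0 b g f (Order≥-0 g)

  Order≥-^ : ∀ h → Order≥ 1 h → ∀ r → Order≥ r (h Ser.^ r)
  Order≥-^ h o zero    = Order≥-0 _
  Order≥-^ h o (suc r) = Order≥-* 1 r h (h Ser.^ r) o (Order≥-^ h o r)

  *ₚ-coeff-cong : ∀ {f f' g g'} k → (∀ i → i ≤ k → f i ≈ f' i) → (∀ i → i ≤ k → g i ≈ g' i) →
                  (f *ₚ g) k ≈ (f' *ₚ g') k
  *ₚ-coeff-cong k ef eg = Σ-cong≤ k (λ i i≤k → *-cong (ef i i≤k) (eg (k ∸ i) (ℕP.m∸n≤m k i)))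

  -- Only meaningful for summable families, where the j-th member has order at least j, so
  -- that the coefficient of degree k gets no contribution from members j > k.
  Σ∞ : (ℕ → PSer) → PSer
  Σ∞ F k = Σ k (λ j → F j k)

  Summable : (ℕ → PSer) → Set ℓ
  Summable F = ∀ j → Order≥ j (F j)

  Σ∞-truncate : ∀ F → Summable F → ∀ N k → k ≤ N → Σ∞ F k ≈ Ser.Σ N F k
  Σ∞-truncate F s N k k≤N = sym (trans (Σ-coeff N F k) (Σ-extend≤ _ k≤N (λ j k<j → s j k k<j)))

  Σ∞-cong : ∀ {F G} → (∀ j → F j ≈ₚ G j) → Σ∞ F ≈ₚ Σ∞ G
  Σ∞-cong e k = Σ-cong k (λ j → e j k)

  Σ∞-*ˡ : ∀ g F → Summable F → g *ₚ Σ∞ F ≈ₚ Σ∞ (λ j → g *ₚ F j)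
  Σ∞-*ˡ g F s k = begin
    (g *ₚ Σ∞ F) k                ≈⟨ *ₚ-coeff-cong k (λ i _ → refl) (λ i i≤k → Σ∞-truncate F s k i i≤k) ⟩
    (g *ₚ Ser.Σ k F) k           ≈⟨ Ser.Σ-*ˡ k g F k ⟩
    Ser.Σ k (λ j → g *ₚ F j) k   ≈⟨ sym (Σ∞-truncate _ (λ j → Order≥-*ˡ j g (F j) (s j)) k k ℕP.≤-refl) ⟩
    Σ∞ (λ j → g *ₚ F j) k        ∎

  Σ∞-Σ : ∀ l (G : ℕ → ℕ → PSer) → Σ∞ (λ j → Ser.Σ l (λ i → G i j)) ≈ₚ Ser.Σ l (λ i → Σ∞ (G i))
  Σ∞-Σ l G k = begin
    Σ k (λ j → Ser.Σ l (λ i → G i j) k) ≈⟨ Σ-cong k (λ j → Σ-coeff l _ k) ⟩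
    Σ k (λ j → Σ l (λ i → G i j k))     ≈⟨ Σ-swap k l _ ⟩
    Σ l (λ i → Σ k (λ j → G i j k))     ≈⟨ sym (Σ-coeff l _ k) ⟩
    Ser.Σ l (λ i → Σ∞ (G i)) k          ∎

  Σ∞-shift : ∀ s F → Summable F → (∀ j → j < s → F j ≈ₚ 0ₚ) → Σ∞ F ≈ₚ Σ∞ (λ b → F (b ℕ.+ s))
  Σ∞-shift s F sm z k = begin
    Σ k (λ j → F j k)            ≈⟨ sym (Σ-extend k s _ (λ j lt → sm j k lt)) ⟩
    Σ (k ℕ.+ s) (λ j → F j k)    ≈⟨ Σ-shift s k _ (λ j lt → z j lt k) ⟩
    Σ k (λ b → F (b ℕ.+ s) k)    ∎

  inv : PSer → PSer
  inv f k = Σ k (λ r → ((1ₚ SerR.- f) Ser.^ r) k)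

  *ₚ-inv : ∀ f → f 0 ≈ 1# → f *ₚ inv f ≈ₚ 1ₚ
  *ₚ-inv f f0≈1 k = begin
    (f *ₚ inv f) k                  ≈⟨ *ₚ-coeff-cong k (λ i _ → refl) inv≈S ⟩
    (f *ₚ S) k                      ≈⟨ sym (+-identityʳ _) ⟩
    (f *ₚ S) k + 0#                 ≈⟨ +-congˡ (sym (Order≥-^ h oh (suc k) k ℕP.≤-refl)) ⟩
    (f *ₚ S) k + (h Ser.^ suc k) k  ≈⟨ Ser.geometric-inverse f k k ⟩
    1ₚ k                            ∎
    where
    h S : PSer
    h = 1ₚ SerR.- f
    S = Ser.Σ k (h Ser.^_)
    oh : Order≥ 1 h
    oh zero _ = trans (+-congˡ (-‿cong f0≈1)) (-‿inverseʳ 1#)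
    oh (suc k) (s≤s ())
    inv≈S : ∀ i → i ≤ k → inv f i ≈ S i
    inv≈S i i≤k = sym (trans (Σ-coeff k _ i) (Σ-extend≤ _ i≤k (λ r i<r → Order≥-^ h oh r i i<r)))

module RisingFactorialSeries {c ℓ} (R : CommutativeRing c ℓ) where
  open CommutativeRing R
  open PowerSeries R
  open NatCombinatorics using (rising; rising-pascal)
  open import Data.Nat as ℕ using (ℕ; zero; suc; _!)
  import Data.Nat.Properties as ℕP
  open import Relation.Binary.Reasoning.Setoid setoid
  open SerSolver using (solve; _:+_; _:*_; _:=_)

  κ1≈1ₚ : κ (fromℕ 1) ≈ₚ 1ₚ
  κ1≈1ₚ = κ-cong (+-identityʳ 1#)

  module _ (u : PSer) (u-order : Order≥ 1 u) where

    risingTerm : ℕ → ℕ → PSer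
    risingTerm K b = κ (fromℕ (rising (suc b) K)) *ₚ u Ser.^ b

    risingSum : ℕ → PSer
    risingSum K = Σ∞ (risingTerm K)

    risingTerm-summable : ∀ K → Summable (risingTerm K)
    risingTerm-summable K b = Order≥-*ˡ b _ _ (Order≥-^ u u-order b)

    risingTerm-suc-0 : ∀ K → risingTerm (suc K) 0 ≈ₚ κ (fromℕ (suc K)) *ₚ risingTerm K 0
    risingTerm-suc-0 K = SerReasoning.begin
      κ (fromℕ (rising 1 K ℕ.* suc K)) *ₚ 1ₚ
        SerReasoning.≈⟨ *ₚ-congʳ 1ₚ (SerR.trans (κ-cong (cong≈ fromℕ (ℕP.*-comm (rising 1 K) (suc K))))
                                                 (κ-fromℕ-* (suc K) (rising 1 K))) ⟩
      (κ (fromℕ (suc K)) *ₚ κ (fromℕ (rising 1 K))) *ₚ 1ₚ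
        SerReasoning.≈⟨ SerR.*-assoc (κ (fromℕ (suc K))) (κ (fromℕ (rising 1 K))) 1ₚ ⟩
      κ (fromℕ (suc K)) *ₚ risingTerm K 0 SerReasoning.∎

    risingTerm-suc-suc : ∀ K b → risingTerm (suc K) (suc b) ≈ₚ
                         κ (fromℕ (suc K)) *ₚ risingTerm K (suc b) +ₚ u *ₚ risingTerm (suc K) b
    risingTerm-suc-suc K b = SerReasoning.begin
      κ (fromℕ (rising (2 ℕ.+ b) (suc K))) *ₚ u Ser.^ suc b
        SerReasoning.≈⟨ *ₚ-congʳ (u Ser.^ suc b) (κ-cong (cong≈ fromℕ (rising-pascal b K))) ⟩
      κ (fromℕ (suc K ℕ.* rising (2 ℕ.+ b) K ℕ.+ rising (suc b) (suc K))) *ₚ u Ser.^ suc b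
        SerReasoning.≈⟨ *ₚ-congʳ (u Ser.^ suc b) (SerR.trans (κ-fromℕ-+ (suc K ℕ.* rising (2 ℕ.+ b) K) (rising (suc b) (suc K)))
                                                              (SerR.+-congʳ (κ-fromℕ-* (suc K) (rising (2 ℕ.+ b) K)))) ⟩
      (κ (fromℕ (suc K)) *ₚ y +ₚ z) *ₚ (u *ₚ u Ser.^ b)
        SerReasoning.≈⟨ solve 5 (λ c y z u ub → (c :* y :+ z) :* (u :* ub) := c :* (y :* (u :* ub)) :+ u :* (z :* ub))
                          SerR.refl (κ (fromℕ (suc K))) y z u (u Ser.^ b) ⟩
      κ (fromℕ (suc K)) *ₚ risingTerm K (suc b) +ₚ u *ₚ risingTerm (suc K) b SerReasoning.∎
      where
      y z : PSer
      y = κ (fromℕ (rising (2 ℕ.+ b) K))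
      z = κ (fromℕ (rising (suc b) (suc K)))

    risingSum-suc : ∀ K → risingSum (suc K) ≈ₚ κ (fromℕ (suc K)) *ₚ risingSum K +ₚ u *ₚ risingSum (suc K)
    risingSum-suc K k = begin
      risingSum (suc K) k
        ≈⟨ Σ∞-truncate _ (risingTerm-summable (suc K)) (suc k) k (ℕP.n≤1+n k) ⟩
      Ser.Σ (suc k) (risingTerm (suc K)) k
        ≈⟨ Ser.Σ-recurrence k (risingTerm (suc K)) (λ b → sucK *ₚ risingTerm K b) u (risingTerm-suc-0 K) (risingTerm-suc-suc K) k ⟩
      Ser.Σ (suc k) (λ b → sucK *ₚ risingTerm K b) k + (u *ₚ Ser.Σ k (risingTerm (suc K))) k
        ≈⟨ +-congʳ (sym (Ser.Σ-*ˡ (suc k) _ _ k)) ⟩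
      (sucK *ₚ Ser.Σ (suc k) (risingTerm K)) k + (u *ₚ Ser.Σ k (risingTerm (suc K))) k
        ≈⟨ +-cong (*ₚ-coeff-cong k (λ i _ → refl) (λ i i≤k → sym (Σ∞-truncate _ (risingTerm-summable K) (suc k) i (ℕP.m≤n⇒m≤1+n i≤k))))
                  (*ₚ-coeff-cong k (λ i _ → refl) (λ i i≤k → sym (Σ∞-truncate _ (risingTerm-summable (suc K)) k i i≤k))) ⟩
      (sucK *ₚ risingSum K) k + (u *ₚ risingSum (suc K)) k ∎
      where
      sucK : PSer
      sucK = κ (fromℕ (suc K))

    risingSum-0 : risingSum 0 ≈ₚ 1ₚ +ₚ u *ₚ risingSum 0
    risingSum-0 k = begin
      risingSum 0 k
        ≈⟨ Σ∞-truncate _ (risingTerm-summable 0) (suc k) k (ℕP.n≤1+n k) ⟩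
      Ser.Σ (suc k) (risingTerm 0) k
        ≈⟨ Ser.Σ-recurrence k (risingTerm 0) δ u (SerR.trans (SerR.*-identityʳ _) κ1≈1ₚ) term-suc k ⟩
      Ser.Σ (suc k) δ k + (u *ₚ Ser.Σ k (risingTerm 0)) k
        ≈⟨ +-cong (Ser.Σ-unfoldˡ k δ k) (*ₚ-coeff-cong k (λ i _ → refl) (λ i i≤k → sym (Σ∞-truncate _ (risingTerm-summable 0) k i i≤k))) ⟩
      (1ₚ +ₚ Ser.Σ k (λ _ → 0ₚ)) k + (u *ₚ risingSum 0) k
        ≈⟨ +-congʳ (trans (+-congˡ (Ser.Σ-zero k _ (λ _ _ → SerR.refl) k)) (+-identityʳ _)) ⟩
      1ₚ k + (u *ₚ risingSum 0) k ∎
      where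
      δ : ℕ → PSer
      δ zero    = 1ₚ
      δ (suc b) = 0ₚ
      term-suc : ∀ b → risingTerm 0 (suc b) ≈ₚ 0ₚ +ₚ u *ₚ risingTerm 0 b
      term-suc b = SerR.trans (SerComm.x∙yz≈y∙xz (κ (fromℕ 1)) u (u Ser.^ b))
                              (SerR.sym (SerR.+-identityˡ _))

    risingSum*[1-u]^suc : ∀ K → risingSum K *ₚ (1ₚ SerR.- u) Ser.^ suc K ≈ₚ κ (fromℕ (K !))
    risingSum*[1-u]^suc zero = SerReasoning.begin
      risingSum 0 *ₚ ((1ₚ SerR.- u) *ₚ 1ₚ) SerReasoning.≈⟨ *ₚ-congˡ (risingSum 0) (SerR.*-identityʳ (1ₚ SerR.- u)) ⟩
      risingSum 0 *ₚ (1ₚ SerR.- u)         SerReasoning.≈⟨ Ser.fixpoint*[1-u] (risingSum 0) 1ₚ u risingSum-0 ⟩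
      1ₚ                                   SerReasoning.≈⟨ SerR.sym κ1≈1ₚ ⟩
      κ (fromℕ 1)                          SerReasoning.∎
    risingSum*[1-u]^suc (suc K) = SerReasoning.begin
      risingSum (suc K) *ₚ ((1ₚ SerR.- u) *ₚ v)
        SerReasoning.≈⟨ SerR.sym (SerR.*-assoc (risingSum (suc K)) (1ₚ SerR.- u) v) ⟩
      (risingSum (suc K) *ₚ (1ₚ SerR.- u)) *ₚ v
        SerReasoning.≈⟨ *ₚ-congʳ v (Ser.fixpoint*[1-u] (risingSum (suc K)) (sucK *ₚ risingSum K) u (risingSum-suc K)) ⟩
      (sucK *ₚ risingSum K) *ₚ v
        SerReasoning.≈⟨ SerR.*-assoc sucK (risingSum K) v ⟩
      sucK *ₚ (risingSum K *ₚ v)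
        SerReasoning.≈⟨ *ₚ-congˡ sucK (risingSum*[1-u]^suc K) ⟩
      sucK *ₚ κ (fromℕ (K !))
        SerReasoning.≈⟨ SerR.sym (κ-fromℕ-* (suc K) (K !)) ⟩
      κ (fromℕ (suc K ℕ.* K !)) SerReasoning.∎
      where
      sucK v : PSer
      sucK = κ (fromℕ (suc K))
      v = (1ₚ SerR.- u) Ser.^ suc K

module Rationals where
  open import Data.Nat as ℕ using (ℕ; zero; suc; _!)
  import Data.Nat.Properties as ℕP
  open import Data.Integer using (+_)
  open import Data.Rational using (ℚ; 1ℚ; _+_; _*_; _/_; mkℚ; toℚᵘ)
  import Data.Rational.Properties as ℚP
  import Data.Rational.Unnormalised as ℚᵘ
  import Data.Rational.Unnormalised.Properties as ℚᵘP
  import Data.Nat.Coprimality as Coprimality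
  import Algebra.Properties.CommutativeSemigroup as CommutativeSemigroupProperties
  open import Relation.Binary.PropositionalEquality
  open import Data.Integer.Solver using (module +-*-Solver)
  open +-*-Solver using (solve; _:+_; _:*_; _:=_; con)
  open ≡-Reasoning

  ℚ-ring : CommutativeRing _ _
  ℚ-ring = ℚP.+-*-commutativeRing

  module ℚSums = FiniteSums ℚ-ring
  module ℚ* = CommutativeSemigroupProperties (CommutativeRing.*-commutativeSemigroup ℚ-ring)

  ι≡mkℚ : ∀ k → ι k ≡ mkℚ (+ k) 0 (Coprimality.sym (Coprimality.1-coprimeTo k))
  ι≡mkℚ k = ℚP.normalize-coprime _

  ι-suc : ∀ k → ι (suc k) ≡ 1ℚ + ι k
  ι-suc k = ℚP.toℚᵘ-injective (ℚᵘP.≃-trans unnormalised (ℚᵘP.≃-sym (ℚP.toℚᵘ-homo-+ 1ℚ (ι k))))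
    where
    unnormalised : toℚᵘ (ι (suc k)) ℚᵘ.≃ (toℚᵘ 1ℚ ℚᵘ.+ toℚᵘ (ι k))
    unnormalised rewrite ι≡mkℚ (suc k) | ι≡mkℚ k =
      ℚᵘ.*≡* (solve 1 (λ x → (con (+ 1) :+ x) :* (con (+ 1) :* con (+ 1)) := (con (+ 1) :* con (+ 1) :+ x :* con (+ 1)) :* con (+ 1)) refl (+ k))

  fromℕ≡ι : ∀ k → ℚSums.fromℕ k ≡ ι k
  fromℕ≡ι zero = refl
  fromℕ≡ι (suc k) = trans (cong (λ q → 1ℚ + q) (fromℕ≡ι k)) (sym (ι-suc k))

  ι-+ : ∀ m n → ι (m ℕ.+ n) ≡ ι m + ι n
  ι-+ m n = trans (sym (fromℕ≡ι (m ℕ.+ n))) (trans (ℚSums.fromℕ-+ m n) (cong₂ _+_ (fromℕ≡ι m) (fromℕ≡ι n)))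

  ι-* : ∀ m n → ι (m ℕ.* n) ≡ ι m * ι n
  ι-* m n = trans (sym (fromℕ≡ι (m ℕ.* n))) (trans (ℚSums.fromℕ-* m n) (cong₂ _*_ (fromℕ≡ι m) (fromℕ≡ι n)))

  ι-^ : ∀ m n → ι (m ℕ.^ n) ≡ ι m ^ℚ n
  ι-^ m n = trans (sym (fromℕ≡ι (m ℕ.^ n))) (trans (ℚSums.fromℕ-^ m n) (^≡^ℚ (ι m) n (fromℕ≡ι m)))
    where
    ^≡^ℚ : ∀ q n → ℚSums.fromℕ m ≡ q → ℚSums.fromℕ m ℚSums.^ n ≡ q ^ℚ n
    ^≡^ℚ q zero    _  = refl
    ^≡^ℚ q (suc n) eq = cong₂ _*_ eq (^≡^ℚ q n eq)

  1/d*d≡1 : ∀ d .{{_ : ℕ.NonZero d}} → (+ 1 / d) * ι d ≡ 1ℚ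
  1/d*d≡1 (suc d) = ℚP.toℚᵘ-injective (ℚᵘP.≃-trans (ℚP.toℚᵘ-homo-* (+ 1 / suc d) (ι (suc d))) unnormalised)
    where
    unnormalised : (toℚᵘ (+ 1 / suc d) ℚᵘ.* toℚᵘ (ι (suc d))) ℚᵘ.≃ toℚᵘ 1ℚ
    unnormalised rewrite ι≡mkℚ (suc d) | ℚP.normalize-coprime {1} {d} (Coprimality.1-coprimeTo (suc d)) =
      ℚᵘ.*≡* (solve 1 (λ x → (con (+ 1) :* (con (+ 1) :+ x)) :* con (+ 1) := con (+ 1) :* ((con (+ 1) :+ x) :* con (+ 1))) refl (+ d))

  *ι-cancelʳ : ∀ d .{{_ : ℕ.NonZero d}} x y → x * ι d ≡ y * ι d → x ≡ y
  *ι-cancelʳ d x y e = begin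
    x                         ≡⟨ sym (ℚP.*-identityʳ x) ⟩
    x * 1ℚ                    ≡⟨ cong (x *_) (sym d*1/d≡1) ⟩
    x * (ι d * (+ 1 / d))     ≡⟨ sym (ℚP.*-assoc x _ _) ⟩
    (x * ι d) * (+ 1 / d)     ≡⟨ cong (_* (+ 1 / d)) e ⟩
    (y * ι d) * (+ 1 / d)     ≡⟨ ℚP.*-assoc y _ _ ⟩
    y * (ι d * (+ 1 / d))     ≡⟨ cong (y *_) d*1/d≡1 ⟩
    y * 1ℚ                    ≡⟨ ℚP.*-identityʳ y ⟩
    y                         ∎
    where
    d*1/d≡1 : ι d * (+ 1 / d) ≡ 1ℚ
    d*1/d≡1 = trans (ℚP.*-comm (ι d) _) (1/d*d≡1 d)

  invFact*! : ∀ k → invFact k * ι (k !) ≡ 1ℚ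
  invFact*! k = 1/d*d≡1 (k !) {{k ℕP.!≢0}}

  invFact-suc : ∀ k → invFact (suc k) * ι (suc k) ≡ invFact k
  invFact-suc k = *ι-cancelʳ (k !) {{k ℕP.!≢0}} _ _ (begin
    invFact (suc k) * ι (suc k) * ι (k !)    ≡⟨ ℚP.*-assoc (invFact (suc k)) _ _ ⟩
    invFact (suc k) * (ι (suc k) * ι (k !))  ≡⟨ cong (invFact (suc k) *_) (sym (ι-* (suc k) (k !))) ⟩
    invFact (suc k) * ι (suc k !)            ≡⟨ invFact*! (suc k) ⟩
    1ℚ                                       ≡⟨ sym (invFact*! k) ⟩
    invFact k * ι (k !)                      ∎)

module RationalSeries where
  open Rationals
  open PowerSeries ℚ-ring public
  open import Data.Nat as ℕ using (ℕ; zero; suc; _∸_; _≤_)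
  import Data.Nat.Properties as ℕP
  open import Data.Rational using (ℚ; 0ℚ; 1ℚ; _+_; _*_; -_)
  import Data.Rational.Properties as ℚP
  open import Data.Rational.Solver using (module +-*-Solver)
  open import Relation.Binary.PropositionalEquality
  open ≡-Reasoning

  ∂ : PSer → PSer
  ∂ f k = ι (suc k) * f (suc k)

  ∂-* : ∀ f g → ∂ (f *ₚ g) ≈ₚ ∂ f *ₚ g +ₚ f *ₚ ∂ g
  ∂-* f g k = begin
    ι (suc k) * Σ (suc k) a                                               ≡⟨ Σ-*ˡ (suc k) (ι (suc k)) a ⟩
    Σ (suc k) (λ i → ι (suc k) * a i)                                     ≡⟨ Σ-cong≤ (suc k) split ⟩
    Σ (suc k) (λ i → ι i * a i + ι (suc k ∸ i) * a i)                     ≡⟨ Σ-+ (suc k) _ _ ⟩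
    Σ (suc k) (λ i → ι i * a i) + Σ (suc k) (λ i → ι (suc k ∸ i) * a i)   ≡⟨ cong₂ _+_ left right ⟩
    (∂ f *ₚ g) k + (f *ₚ ∂ g) k                                           ∎
    where
    a : ℕ → ℚ
    a i = f i * g (suc k ∸ i)
    split : ∀ i → i ≤ suc k → ι (suc k) * a i ≡ ι i * a i + ι (suc k ∸ i) * a i
    split i i≤ = trans (cong (_* a i) (trans (cong ι (sym (ℕP.m+[n∸m]≡n i≤))) (ι-+ i (suc k ∸ i))))
                       (ℚP.*-distribʳ-+ (a i) (ι i) _)
    left : Σ (suc k) (λ i → ι i * a i) ≡ (∂ f *ₚ g) k
    left = begin
      Σ (suc k) (λ i → ι i * a i)                        ≡⟨ Σ-unfoldˡ k _ ⟩
      ι 0 * a 0 + Σ k (λ i → ι (suc i) * a (suc i))      ≡⟨ cong (_+ Σ k (λ i → ι (suc i) * a (suc i))) (ℚP.*-zeroˡ (a 0)) ⟩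
      0ℚ + Σ k (λ i → ι (suc i) * a (suc i))             ≡⟨ ℚP.+-identityˡ _ ⟩
      Σ k (λ i → ι (suc i) * (f (suc i) * g (k ∸ i)))    ≡⟨ Σ-cong k (λ i → sym (ℚP.*-assoc (ι (suc i)) (f (suc i)) (g (k ∸ i)))) ⟩
      (∂ f *ₚ g) k                                       ∎
    right : Σ (suc k) (λ i → ι (suc k ∸ i) * a i) ≡ (f *ₚ ∂ g) k
    right = begin
      Σ k (λ i → ι (suc k ∸ i) * a i) + ι (suc k ∸ suc k) * a (suc k)
        ≡⟨ cong (Σ k (λ i → ι (suc k ∸ i) * a i) +_) (trans (cong (λ v → ι v * a (suc k)) (ℕP.n∸n≡0 k)) (ℚP.*-zeroˡ (a (suc k)))) ⟩
      Σ k (λ i → ι (suc k ∸ i) * a i) + 0ℚ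
        ≡⟨ ℚP.+-identityʳ _ ⟩
      Σ k (λ i → ι (suc k ∸ i) * a i)
        ≡⟨ Σ-cong≤ k (λ i i≤ → trans (cong (λ v → ι v * (f i * g v)) (ℕP.+-∸-assoc 1 i≤))
             (ℚ*.x∙yz≈y∙xz (ι (suc (k ∸ i))) (f i) (g (suc (k ∸ i))))) ⟩
      (f *ₚ ∂ g) k ∎

  ∂-cong : ∀ {f g} → f ≈ₚ g → ∂ f ≈ₚ ∂ g
  ∂-cong f≈g k = cong (ι (suc k) *_) (f≈g (suc k))

  ∂-^ : ∀ f i → ∂ (f Ser.^ suc i) ≈ₚ κ (ι (suc i)) *ₚ (f Ser.^ i *ₚ ∂ f)
  ∂-^ f zero k = begin
    ∂ (f *ₚ 1ₚ) k               ≡⟨ ∂-cong (SerR.*-identityʳ f) k ⟩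
    ∂ f k                       ≡⟨ sym (SerR.*-identityˡ (∂ f) k) ⟩
    (1ₚ *ₚ ∂ f) k               ≡⟨ sym (SerR.*-identityˡ (1ₚ *ₚ ∂ f) k) ⟩
    (κ 1ℚ *ₚ (1ₚ *ₚ ∂ f)) k     ∎
  ∂-^ f (suc i) k = begin
    ∂ (f *ₚ f^) k                                          ≡⟨ ∂-* f f^ k ⟩
    (∂ f *ₚ f^) k + (f *ₚ ∂ f^) k                          ≡⟨ cong ((∂ f *ₚ f^) k +_) (*ₚ-congˡ f (∂-^ f i) k) ⟩
    (∂ f *ₚ (f *ₚ g) +ₚ f *ₚ (κ (ι (suc i)) *ₚ (g *ₚ ∂ f))) k
      ≡⟨ SerSolver.solve 4 (λ e f g c → e :* (f :* g) :+ f :* (c :* (g :* e)) := (SerSolver.con 1 :+ c) :* ((f :* g) :* e))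
                           SerR.refl (∂ f) f g (κ (ι (suc i))) k ⟩
    ((1ₚ +ₚ κ (ι (suc i))) *ₚ (f^ *ₚ ∂ f)) k
      ≡⟨ *ₚ-congʳ (f^ *ₚ ∂ f) (λ j → trans (κ-+ 1ℚ (ι (suc i)) j) (cong (λ q → κ q j) (sym (ι-suc (suc i))))) k ⟩
    (κ (ι (suc (suc i))) *ₚ (f^ *ₚ ∂ f)) k                 ∎
    where
    open SerSolver using (_:+_; _:*_; _:=_)
    g f^ : PSer
    g  = f Ser.^ i
    f^ = f Ser.^ suc i

  linear-ode-unique : ∀ (f g q : PSer) (c : ℚ) → (∀ k → ∂ f k ≡ c * f k + q k) → (∀ k → ∂ g k ≡ c * g k + q k) →
                      f 0 ≡ g 0 → f ≈ₚ g
  linear-ode-unique f g q c ∂f ∂g f0≡g0 zero = f0≡g0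
  linear-ode-unique f g q c ∂f ∂g f0≡g0 (suc k) = *ι-cancelʳ (suc k) _ _ (begin
    f (suc k) * ι (suc k) ≡⟨ ℚP.*-comm (f (suc k)) (ι (suc k)) ⟩
    ∂ f k                 ≡⟨ ∂f k ⟩
    c * f k + q k         ≡⟨ cong (λ v → c * v + q k) (linear-ode-unique f g q c ∂f ∂g f0≡g0 k) ⟩
    c * g k + q k         ≡⟨ sym (∂g k) ⟩
    ∂ g k                 ≡⟨ ℚP.*-comm (ι (suc k)) (g (suc k)) ⟩
    g (suc k) * ι (suc k) ∎)

  ∂-exp : ∀ c k → ∂ (expSeries c) k ≡ c * expSeries c k
  ∂-exp c k = begin
    ι (suc k) * ((c * (c ^ℚ k)) * invFact (suc k))
      ≡⟨ solve 4 (λ a c p i → a :* ((c :* p) :* i) := c :* p :* (i :* a)) refl (ι (suc k)) c (c ^ℚ k) (invFact (suc k)) ⟩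
    c * (c ^ℚ k) * (invFact (suc k) * ι (suc k))  ≡⟨ cong (c * (c ^ℚ k) *_) (invFact-suc k) ⟩
    c * (c ^ℚ k) * invFact k                      ≡⟨ ℚP.*-assoc c _ _ ⟩
    c * expSeries c k                             ∎
    where open +-*-Solver using (solve; _:*_; _:=_)

  exp-+ : ∀ a b → expSeries a *ₚ expSeries b ≈ₚ expSeries (a + b)
  exp-+ a b = linear-ode-unique _ _ (λ _ → 0ℚ) (a + b) ∂F ∂E refl
    where
    F : PSer
    F = expSeries a *ₚ expSeries b
    ∂F : ∀ k → ∂ F k ≡ (a + b) * F k + 0ℚ
    ∂F k = begin
      ∂ F k
        ≡⟨ ∂-* (expSeries a) (expSeries b) k ⟩
      (∂ (expSeries a) *ₚ expSeries b) k + (expSeries a *ₚ ∂ (expSeries b)) k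
        ≡⟨ cong₂ _+_ (*ₚ-congʳ (expSeries b) (λ i → trans (∂-exp a i) (sym (κ-*ₚ a (expSeries a) i))) k)
                     (*ₚ-congˡ (expSeries a) (λ i → trans (∂-exp b i) (sym (κ-*ₚ b (expSeries b) i))) k) ⟩
      ((κ a *ₚ expSeries a) *ₚ expSeries b) k + (expSeries a *ₚ (κ b *ₚ expSeries b)) k
        ≡⟨ cong₂ _+_ (SerR.*-assoc (κ a) (expSeries a) (expSeries b) k)
                     (SerComm.x∙yz≈y∙xz (expSeries a) (κ b) (expSeries b) k) ⟩
      (κ a *ₚ F) k + (κ b *ₚ F) k
        ≡⟨ cong₂ _+_ (κ-*ₚ a F k) (κ-*ₚ b F k) ⟩
      a * F k + b * F k
        ≡⟨ sym (trans (ℚP.+-identityʳ _) (ℚP.*-distribʳ-+ (F k) a b)) ⟩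
      (a + b) * F k + 0ℚ ∎
    ∂E : ∀ k → ∂ (expSeries (a + b)) k ≡ (a + b) * expSeries (a + b) k + 0ℚ
    ∂E k = trans (∂-exp (a + b) k) (sym (ℚP.+-identityʳ _))

  exp-0 : expSeries 0ℚ ≈ₚ 1ₚ
  exp-0 zero = refl
  exp-0 (suc k) = trans (cong (_* invFact (suc k)) (ℚP.*-zeroˡ (0ℚ ^ℚ k))) (ℚP.*-zeroˡ (invFact (suc k)))

  eᵗ e⁻ᵗ : PSer
  eᵗ  = expSeries 1ℚ
  e⁻ᵗ = expSeries (- 1ℚ)

  e⁻ᵗ*eᵗ : e⁻ᵗ *ₚ eᵗ ≈ₚ 1ₚ
  e⁻ᵗ*eᵗ k = trans (exp-+ (- 1ℚ) 1ℚ k) (exp-0 k)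

  exp-ℕ : ∀ n → expSeries (ι n) ≈ₚ eᵗ Ser.^ n
  exp-ℕ zero = exp-0
  exp-ℕ (suc n) k = begin
    expSeries (ι (suc n)) k        ≡⟨ cong (λ v → expSeries v k) (ι-suc n) ⟩
    expSeries (1ℚ + ι n) k         ≡⟨ sym (exp-+ 1ℚ (ι n) k) ⟩
    (eᵗ *ₚ expSeries (ι n)) k      ≡⟨ *ₚ-congˡ eᵗ (exp-ℕ n) k ⟩
    (eᵗ *ₚ eᵗ Ser.^ n) k           ∎

  exp-neg*eᵗ^ : ∀ n → expSeries (- ι n) *ₚ eᵗ Ser.^ n ≈ₚ 1ₚ
  exp-neg*eᵗ^ n k = begin
    (expSeries (- ι n) *ₚ eᵗ Ser.^ n) k           ≡⟨ *ₚ-congˡ (expSeries (- ι n)) (SerR.sym (exp-ℕ n)) k ⟩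
    (expSeries (- ι n) *ₚ expSeries (ι n)) k      ≡⟨ exp-+ (- ι n) (ι n) k ⟩
    expSeries (- ι n + ι n) k                     ≡⟨ cong (λ v → expSeries v k) (ℚP.+-inverseˡ (ι n)) ⟩
    expSeries 0ℚ k                                ≡⟨ exp-0 k ⟩
    1ₚ k                                          ∎

module DefsAsSeries where
  open Rationals
  open RationalSeries
  open import Data.Nat as ℕ using (ℕ; zero; suc)
  open import Data.Rational using (1ℚ; _+_; _*_; -_)
  open import Relation.Binary.PropositionalEquality

  sumTo≡Σ : ∀ n f → sumTo n f ≡ Σ n f
  sumTo≡Σ zero    f = refl
  sumTo≡Σ (suc n) f = cong (_+ f (suc n)) (sumTo≡Σ n f)

  const₁≈κ : ∀ a → const₁ a ≈ₚ κ a
  const₁≈κ a zero    = refl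
  const₁≈κ a (suc k) = refl

  *₁≈*ₚ : ∀ {f f' g g'} → f ≈ₚ f' → g ≈ₚ g' → f *₁ g ≈ₚ f' *ₚ g'
  *₁≈*ₚ ef eg k = trans (sumTo≡Σ k _) (*ₚ-cong ef eg k)

  -₁≈- : ∀ {f f' g g'} → f ≈ₚ f' → g ≈ₚ g' → f -₁ g ≈ₚ f' SerR.- g'
  -₁≈- ef eg k = cong₂ (λ a b → a + - b) (ef k) (eg k)

  ·₁≈κ*ₚ : ∀ a {f f'} → f ≈ₚ f' → a ·₁ f ≈ₚ κ a *ₚ f'
  ·₁≈κ*ₚ a {f' = f'} e k = trans (cong (a *_) (e k)) (sym (κ-*ₚ a f' k))

  ^₁≈^ : ∀ {f f'} → f ≈ₚ f' → ∀ r → f ^₁ r ≈ₚ f' Ser.^ r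
  ^₁≈^ e zero    = const₁≈κ 1ℚ
  ^₁≈^ e (suc r) = *₁≈*ₚ e (^₁≈^ e r)

  inv₁≈inv : ∀ {f f'} → f ≈ₚ f' → inv₁ f ≈ₚ inv f'
  inv₁≈inv e k = trans (sumTo≡Σ k _) (Σ-cong k (λ r → ^₁≈^ (-₁≈- (const₁≈κ 1ℚ) e) r k))

module StirlingIdentities where
  open Rationals
  open RationalSeries
  open NatCombinatorics
  open import Data.Nat as ℕ using (ℕ; zero; suc)
  import Data.Nat.Properties as ℕP
  open import Data.Rational using (ℚ; 0ℚ; _+_; _*_)
  import Data.Rational.Properties as ℚP
  open import Data.Nat.Solver using () renaming (module +-*-Solver to ℕ-Solver)
  open import Algebra.Properties.CommutativeSemigroup ℕP.*-commutativeSemigroup using (x∙yz≈y∙xz)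
  open import Algebra.Properties.CommutativeSemigroup (CommutativeRing.+-commutativeSemigroup ℚ-ring)
    using () renaming (x∙yz≈y∙xz to x+[y+z]≡y+[x+z])
  open import Relation.Binary.PropositionalEquality
  open ≡-Reasoning

  ι-zero : ∀ {k} → k ≡ 0 → ι k ≡ 0ℚ
  ι-zero refl = refl

  Σ-unfoldˡ-last≡0 : ∀ n (g : ℕ → ℚ) → g (suc n) ≡ 0ℚ → Σ n g ≡ g 0 + Σ n (λ i → g (suc i))
  Σ-unfoldˡ-last≡0 n g g[1+n]≡0 = begin
    Σ n g                         ≡⟨ sym (ℚP.+-identityʳ (Σ n g)) ⟩
    Σ n g + 0ℚ                    ≡⟨ cong (Σ n g +_) (sym g[1+n]≡0) ⟩
    Σ (suc n) g                   ≡⟨ Σ-unfoldˡ n g ⟩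
    g 0 + Σ n (λ i → g (suc i))   ∎

  Σstirling1*^≡rising : ∀ x n → Σ n (λ j → ι (stirling1 n j ℕ.* x ℕ.^ j)) ≡ ι (rising x n)
  Σstirling1*^≡rising x zero = refl
  Σstirling1*^≡rising x (suc n) = begin
    Σ (suc n) (λ j → term (suc n) j)                                       ≡⟨ Σ-unfoldˡ n _ ⟩
    ι 0 + Σ n (λ j → term (suc n) (suc j))                                 ≡⟨ ℚP.+-identityˡ (Σ n (λ j → term (suc n) (suc j))) ⟩
    Σ n (λ j → term (suc n) (suc j))                                       ≡⟨ Σ-cong n recurrence ⟩
    Σ n (λ j → ι x * term n j + ι n * term n (suc j))                      ≡⟨ Σ-+ n _ _ ⟩
    Σ n (λ j → ι x * term n j) + Σ n (λ j → ι n * term n (suc j))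
      ≡⟨ cong₂ _+_ (sym (Σ-*ˡ n (ι x) _)) (trans (sym (Σ-*ˡ n (ι n) _)) (n*shifted n)) ⟩
    ι x * S + ι n * S                                                      ≡⟨ sym (ℚP.*-distribʳ-+ S (ι x) (ι n)) ⟩
    (ι x + ι n) * S                                                        ≡⟨ cong₂ _*_ (sym (ι-+ x n)) (Σstirling1*^≡rising x n) ⟩
    ι (x ℕ.+ n) * ι (rising x n)                                           ≡⟨ sym (ι-* (x ℕ.+ n) (rising x n)) ⟩
    ι ((x ℕ.+ n) ℕ.* rising x n)                                           ≡⟨ cong ι (ℕP.*-comm (x ℕ.+ n) (rising x n)) ⟩
    ι (rising x (suc n))                                                   ∎
    where
    term : ℕ → ℕ → ℚ
    term m j = ι (stirling1 m j ℕ.* x ℕ.^ j)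
    S : ℚ
    S = Σ n (term n)
    recurrence : ∀ j → term (suc n) (suc j) ≡ ι x * term n j + ι n * term n (suc j)
    recurrence j = begin
      ι ((stirling1 n j ℕ.+ n ℕ.* stirling1 n (suc j)) ℕ.* (x ℕ.* x ℕ.^ j))
        ≡⟨ cong ι (solve 5 (λ s t n x xj → (s :+ n :* t) :* (x :* xj) := x :* (s :* xj) :+ n :* (t :* (x :* xj)))
                         refl (stirling1 n j) (stirling1 n (suc j)) n x (x ℕ.^ j)) ⟩
      ι (x ℕ.* (stirling1 n j ℕ.* x ℕ.^ j) ℕ.+ n ℕ.* (stirling1 n (suc j) ℕ.* x ℕ.^ suc j))
        ≡⟨ trans (ι-+ (x ℕ.* a) (n ℕ.* b)) (cong₂ _+_ (ι-* x a) (ι-* n b)) ⟩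
      ι x * term n j + ι n * term n (suc j) ∎
      where
      open ℕ-Solver using (solve; _:+_; _:*_; _:=_)
      a b : ℕ
      a = stirling1 n j ℕ.* x ℕ.^ j
      b = stirling1 n (suc j) ℕ.* x ℕ.^ suc j
    -- [n, n+1] = 0 and, for n > 0, [n, 0] = 0, so shifting the index does not change the sum.
    n*shifted : ∀ n → ι n * Σ n (λ j → ι (stirling1 n (suc j) ℕ.* x ℕ.^ suc j)) ≡ ι n * Σ n (λ j → ι (stirling1 n j ℕ.* x ℕ.^ j))
    n*shifted zero = trans (ℚP.*-zeroˡ (ι (stirling1 0 1 ℕ.* x ℕ.^ 1))) (sym (ℚP.*-zeroˡ (ι (stirling1 0 0 ℕ.* x ℕ.^ 0))))
    n*shifted (suc m) = cong (ι (suc m) *_) (sym (begin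
      Σ (suc m) g
        ≡⟨ Σ-unfoldˡ-last≡0 (suc m) g (ι-zero (cong (ℕ._* (x ℕ.^ suc (suc m))) (stirling1-vanishes (suc m) (suc (suc m)) (ℕP.n<1+n (suc m))))) ⟩
      g 0 + Σ (suc m) (λ j → g (suc j)) ≡⟨ ℚP.+-identityˡ (Σ (suc m) (λ j → g (suc j))) ⟩
      Σ (suc m) (λ j → g (suc j))       ∎))
      where
      g : ℕ → ℚ
      g j = ι (stirling1 (suc m) j ℕ.* x ℕ.^ j)

  Σstirling1*^[l+]≡^*rising : ∀ x l n → Σ n (λ j → ι (stirling1 n j) * ι (x ℕ.^ (l ℕ.+ j))) ≡ ι (x ℕ.^ l ℕ.* rising x n)
  Σstirling1*^[l+]≡^*rising x l n = begin
    Σ n (λ j → ι (stirling1 n j) * ι (x ℕ.^ (l ℕ.+ j)))      ≡⟨ Σ-cong n factor ⟩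
    Σ n (λ j → ι (x ℕ.^ l) * ι (stirling1 n j ℕ.* x ℕ.^ j))  ≡⟨ sym (Σ-*ˡ n (ι (x ℕ.^ l)) _) ⟩
    ι (x ℕ.^ l) * Σ n (λ j → ι (stirling1 n j ℕ.* x ℕ.^ j))  ≡⟨ cong (ι (x ℕ.^ l) *_) (Σstirling1*^≡rising x n) ⟩
    ι (x ℕ.^ l) * ι (rising x n)                             ≡⟨ sym (ι-* (x ℕ.^ l) (rising x n)) ⟩
    ι (x ℕ.^ l ℕ.* rising x n)                               ∎
    where
    factor : ∀ j → ι (stirling1 n j) * ι (x ℕ.^ (l ℕ.+ j)) ≡ ι (x ℕ.^ l) * ι (stirling1 n j ℕ.* x ℕ.^ j)
    factor j = begin
      ι (stirling1 n j) * ι (x ℕ.^ (l ℕ.+ j))        ≡⟨ sym (ι-* (stirling1 n j) _) ⟩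
      ι (stirling1 n j ℕ.* x ℕ.^ (l ℕ.+ j))          ≡⟨ cong (λ p → ι (stirling1 n j ℕ.* p)) (ℕP.^-distribˡ-+-* x l j) ⟩
      ι (stirling1 n j ℕ.* (x ℕ.^ l ℕ.* x ℕ.^ j))    ≡⟨ cong ι (x∙yz≈y∙xz (stirling1 n j) (x ℕ.^ l) (x ℕ.^ j)) ⟩
      ι (x ℕ.^ l ℕ.* (stirling1 n j ℕ.* x ℕ.^ j))    ≡⟨ ι-* (x ℕ.^ l) _ ⟩
      ι (x ℕ.^ l) * ι (stirling1 n j ℕ.* x ℕ.^ j)    ∎

  suc^≡Σstirling2⁺*falling : ∀ a l → ι (suc a ℕ.^ l) ≡ Σ l (λ i → ι (stirling2⁺ l i ℕ.* falling a i))
  suc^≡Σstirling2⁺*falling a zero = refl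
  suc^≡Σstirling2⁺*falling a (suc l) = begin
    ι (suc a ℕ.* suc a ℕ.^ l)
      ≡⟨ ι-* (suc a) (suc a ℕ.^ l) ⟩
    ι (suc a) * ι (suc a ℕ.^ l)
      ≡⟨ cong (ι (suc a) *_) (suc^≡Σstirling2⁺*falling a l) ⟩
    ι (suc a) * Σ l (λ i → ι (stirling2⁺ l i ℕ.* falling a i))
      ≡⟨ Σ-*ˡ l (ι (suc a)) _ ⟩
    Σ l (λ i → ι (suc a) * ι (stirling2⁺ l i ℕ.* falling a i))
      ≡⟨ Σ-cong l (λ i → trans (sym (ι-* (suc a) (stirling2⁺ l i ℕ.* falling a i))) (trans (cong ι (split i)) (ι-+ (A i) (B i)))) ⟩
    Σ l (λ i → ι (A i) + ι (B i))
      ≡⟨ Σ-+ l _ _ ⟩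
    Σ l (λ i → ι (A i)) + Σ l (λ i → ι (B i))
      ≡⟨ cong (Σ l (λ i → ι (A i)) +_) (Σ-unfoldˡ-last≡0 l (λ i → ι (B i)) (ι-zero B[1+l]≡0)) ⟩
    Σ l (λ i → ι (A i)) + (ι (B 0) + Σ l (λ i → ι (B (suc i))))
      ≡⟨ x+[y+z]≡y+[x+z] (Σ l (λ i → ι (A i))) (ι (B 0)) (Σ l (λ i → ι (B (suc i)))) ⟩
    ι (B 0) + (Σ l (λ i → ι (A i)) + Σ l (λ i → ι (B (suc i))))
      ≡⟨ cong₂ _+_ (cong ι B0) (sym (Σ-+ l _ _)) ⟩
    ι (stirling2⁺ (suc l) 0 ℕ.* 1) + Σ l (λ i → ι (A i) + ι (B (suc i)))
      ≡⟨ cong (ι (stirling2⁺ (suc l) 0 ℕ.* 1) +_) (Σ-cong l (λ i → trans (sym (ι-+ (A i) (B (suc i)))) (cong ι (A+B i)))) ⟩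
    ι (stirling2⁺ (suc l) 0 ℕ.* 1) + Σ l (λ i → ι (stirling2⁺ (suc l) (suc i) ℕ.* falling a (suc i)))
      ≡⟨ sym (Σ-unfoldˡ l _) ⟩
    Σ (suc l) (λ i → ι (stirling2⁺ (suc l) i ℕ.* falling a i)) ∎
    where
    open ℕ-Solver using (solve; _:+_; _:*_; _:=_)
    A B : ℕ → ℕ
    A i = stirling2⁺ l i ℕ.* falling a (suc i)
    B i = suc i ℕ.* stirling2⁺ l i ℕ.* falling a i
    split : ∀ i → suc a ℕ.* (stirling2⁺ l i ℕ.* falling a i) ≡ A i ℕ.+ B i
    split i = begin
      suc a ℕ.* (stirling2⁺ l i ℕ.* falling a i)                          ≡⟨ x∙yz≈y∙xz (suc a) (stirling2⁺ l i) (falling a i) ⟩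
      stirling2⁺ l i ℕ.* (suc a ℕ.* falling a i)                          ≡⟨ cong (stirling2⁺ l i ℕ.*_) (suc*falling a i) ⟩
      stirling2⁺ l i ℕ.* (falling a (suc i) ℕ.+ suc i ℕ.* falling a i)
        ≡⟨ solve 4 (λ s f c g → s :* (f :+ c :* g) := s :* f :+ c :* s :* g) refl (stirling2⁺ l i) (falling a (suc i)) (suc i) (falling a i) ⟩
      A i ℕ.+ B i                                                        ∎
    A+B : ∀ i → A i ℕ.+ B (suc i) ≡ stirling2⁺ (suc l) (suc i) ℕ.* falling a (suc i)
    A+B i = sym (ℕP.*-distribʳ-+ (falling a (suc i)) (stirling2⁺ l i) (suc (suc i) ℕ.* stirling2⁺ l (suc i)))
    B[1+l]≡0 : B (suc l) ≡ 0
    B[1+l]≡0 = trans (cong (λ s → suc (suc l) ℕ.* s ℕ.* falling a (suc l)) (stirling2⁺-vanishes l (suc l) (ℕP.n<1+n l)))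
                     (cong (ℕ._* falling a (suc l)) (ℕP.*-zeroʳ (suc (suc l))))
    B0 : B 0 ≡ stirling2⁺ (suc l) 0 ℕ.* 1
    B0 = cong (ℕ._* 1) (ℕP.+-identityʳ (stirling2⁺ l 0))

module ExpPowers where
  open Rationals
  open RationalSeries
  open NatCombinatorics using (stirling2⁺)
  open import Data.Nat as ℕ using (ℕ; zero; suc; _!)
  open import Data.Rational using (ℚ; 0ℚ; 1ℚ; _+_; _*_)
  import Data.Rational.Properties as ℚP
  open import Data.Rational.Solver using (module +-*-Solver)
  open import Relation.Binary.PropositionalEquality
  open ≡-Reasoning

  expm1 : PSer
  expm1 = eᵗ SerR.- 1ₚ

  expm1^*eᵗ : ℕ → PSer
  expm1^*eᵗ i = expm1 Ser.^ i *ₚ eᵗ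

  stirling2⁺EGF : ℕ → PSer
  stirling2⁺EGF i m = ι (i !) * ι (stirling2⁺ m i) * invFact m

  ∂-eᵗ : ∂ eᵗ ≈ₚ eᵗ
  ∂-eᵗ k = trans (∂-exp 1ℚ k) (ℚP.*-identityˡ (eᵗ k))

  ∂-expm1 : ∂ expm1 ≈ₚ eᵗ
  ∂-expm1 k = trans (cong (ι (suc k) *_) (ℚP.+-identityʳ (eᵗ (suc k)))) (∂-eᵗ k)

  expm1+1≈eᵗ : expm1 +ₚ 1ₚ ≈ₚ eᵗ
  expm1+1≈eᵗ k = solve 2 (λ e o → (e :+ :- o) :+ o := e) refl (eᵗ k) (1ₚ k)
    where open +-*-Solver using (solve; _:+_; :-_; _:=_)

  ∂-expm1^*eᵗ-0 : ∀ k → ∂ (expm1^*eᵗ 0) k ≡ 1ℚ * expm1^*eᵗ 0 k + 0ℚ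
  ∂-expm1^*eᵗ-0 k = begin
    ∂ (1ₚ *ₚ eᵗ) k                 ≡⟨ ∂-cong (SerR.*-identityˡ eᵗ) k ⟩
    ∂ eᵗ k                         ≡⟨ ∂-eᵗ k ⟩
    eᵗ k                           ≡⟨ sym (SerR.*-identityˡ eᵗ k) ⟩
    expm1^*eᵗ 0 k                  ≡⟨ solve 1 (λ x → x := con 1ℚ :* x :+ con 0ℚ) refl (expm1^*eᵗ 0 k) ⟩
    1ℚ * expm1^*eᵗ 0 k + 0ℚ        ∎
    where open +-*-Solver using (solve; _:+_; _:*_; _:=_; con)

  -- The derivative of (e^t-1)^(i+1) e^t is (i+1)(e^t-1)^i e^(2t) + (e^t-1)^(i+1) e^t; writing
  -- e^t = (e^t-1) + 1 in the first term gives the Stirling recurrence.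
  ∂-expm1^*eᵗ-suc : ∀ i k → ∂ (expm1^*eᵗ (suc i)) k ≡ ι (2 ℕ.+ i) * expm1^*eᵗ (suc i) k + ι (suc i) * expm1^*eᵗ i k
  ∂-expm1^*eᵗ-suc i k = begin
    ∂ (expm1 Ser.^ suc i *ₚ eᵗ) k
      ≡⟨ ∂-* (expm1 Ser.^ suc i) eᵗ k ⟩
    (∂ (expm1 Ser.^ suc i) *ₚ eᵗ) k + (expm1 Ser.^ suc i *ₚ ∂ eᵗ) k
      ≡⟨ cong₂ _+_ (*ₚ-cong (SerR.trans (∂-^ expm1 i) (*ₚ-congˡ (κ (ι (suc i))) (*ₚ-congˡ (expm1 Ser.^ i) ∂-expm1)))
                            (SerR.sym expm1+1≈eᵗ) k)
                   (*ₚ-congˡ (expm1 Ser.^ suc i) ∂-eᵗ k) ⟩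
    ((κ (ι (suc i)) *ₚ (g *ₚ eᵗ)) *ₚ (expm1 +ₚ 1ₚ) +ₚ (expm1 *ₚ g) *ₚ eᵗ) k
      ≡⟨ solve 4 (λ c g e h → (c :* (g :* e)) :* (h :+ con 1) :+ (h :* g) :* e
                             := (con 1 :+ c) :* ((h :* g) :* e) :+ c :* (g :* e)) SerR.refl (κ (ι (suc i))) g eᵗ expm1 k ⟩
    ((1ₚ +ₚ κ (ι (suc i))) *ₚ expm1^*eᵗ (suc i) +ₚ κ (ι (suc i)) *ₚ expm1^*eᵗ i) k
      ≡⟨ cong (_+ (κ (ι (suc i)) *ₚ expm1^*eᵗ i) k)
              (*ₚ-congʳ (expm1^*eᵗ (suc i)) (λ j → trans (κ-+ 1ℚ (ι (suc i)) j) (cong (λ q → κ q j) (sym (ι-suc (suc i))))) k) ⟩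
    (κ (ι (2 ℕ.+ i)) *ₚ expm1^*eᵗ (suc i)) k + (κ (ι (suc i)) *ₚ expm1^*eᵗ i) k
      ≡⟨ cong₂ _+_ (κ-*ₚ (ι (2 ℕ.+ i)) (expm1^*eᵗ (suc i)) k) (κ-*ₚ (ι (suc i)) (expm1^*eᵗ i) k) ⟩
    ι (2 ℕ.+ i) * expm1^*eᵗ (suc i) k + ι (suc i) * expm1^*eᵗ i k ∎
    where
    open SerSolver using (solve; _:+_; _:*_; _:=_; con)
    g : PSer
    g = expm1 Ser.^ i

  ∂-stirling2⁺EGF : ∀ i k → ∂ (stirling2⁺EGF i) k ≡ ι (i !) * ι (stirling2⁺ (suc k) i) * invFact k
  ∂-stirling2⁺EGF i k = begin
    ι (suc k) * (F * s * invFact (suc k))   ≡⟨ solve 4 (λ a f s v → a :* (f :* s :* v) := f :* s :* (v :* a)) refl (ι (suc k)) F s (invFact (suc k)) ⟩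
    F * s * (invFact (suc k) * ι (suc k))   ≡⟨ cong (F * s *_) (invFact-suc k) ⟩
    F * s * invFact k                       ∎
    where
    open +-*-Solver using (solve; _:*_; _:=_)
    F s : ℚ
    F = ι (i !)
    s = ι (stirling2⁺ (suc k) i)

  ∂-stirling2⁺EGF-0 : ∀ k → ∂ (stirling2⁺EGF 0) k ≡ 1ℚ * stirling2⁺EGF 0 k + 0ℚ
  ∂-stirling2⁺EGF-0 k = trans (∂-stirling2⁺EGF 0 k) (solve 1 (λ x → x := con 1ℚ :* x :+ con 0ℚ) refl (stirling2⁺EGF 0 k))
    where open +-*-Solver using (solve; _:+_; _:*_; _:=_; con)

  ∂-stirling2⁺EGF-suc : ∀ i k → ∂ (stirling2⁺EGF (suc i)) k ≡ ι (2 ℕ.+ i) * stirling2⁺EGF (suc i) k + ι (suc i) * stirling2⁺EGF i k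
  ∂-stirling2⁺EGF-suc i k = begin
    ∂ (stirling2⁺EGF (suc i)) k                     ≡⟨ ∂-stirling2⁺EGF (suc i) k ⟩
    F * ι (stirling2⁺ k i ℕ.+ (2 ℕ.+ i) ℕ.* d) * v
      ≡⟨ cong (λ x → F * x * v) (trans (ι-+ (stirling2⁺ k i) _) (cong (ι (stirling2⁺ k i) +_) (ι-* (2 ℕ.+ i) d))) ⟩
    F * (s + ι (2 ℕ.+ i) * ι d) * v
      ≡⟨ solve 5 (λ F s t d v → F :* (s :+ t :* d) :* v := t :* (F :* d :* v) :+ F :* s :* v) refl F s (ι (2 ℕ.+ i)) (ι d) v ⟩
    ι (2 ℕ.+ i) * (F * ι d * v) + F * s * v        ≡⟨ cong (λ x → ι (2 ℕ.+ i) * (F * ι d * v) + x * s * v) (ι-* (suc i) (i !)) ⟩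
    ι (2 ℕ.+ i) * (F * ι d * v) + ι (suc i) * ι (i !) * s * v
      ≡⟨ cong (ι (2 ℕ.+ i) * (F * ι d * v) +_) (solve 4 (λ p f s v → p :* f :* s :* v := p :* (f :* s :* v)) refl (ι (suc i)) (ι (i !)) s v) ⟩
    ι (2 ℕ.+ i) * stirling2⁺EGF (suc i) k + ι (suc i) * stirling2⁺EGF i k ∎
    where
    open +-*-Solver using (solve; _:+_; _:*_; _:=_)
    F s v : ℚ
    d : ℕ
    F = ι (suc i !)
    d = stirling2⁺ k (suc i)
    s = ι (stirling2⁺ k i)
    v = invFact k

  expm1^*eᵗ≈stirling2⁺EGF : ∀ i → expm1^*eᵗ i ≈ₚ stirling2⁺EGF i
  expm1^*eᵗ≈stirling2⁺EGF zero = linear-ode-unique _ _ (λ _ → 0ℚ) 1ℚ ∂-expm1^*eᵗ-0 ∂-stirling2⁺EGF-0 refl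
  expm1^*eᵗ≈stirling2⁺EGF (suc i) =
    linear-ode-unique _ _ (λ k → ι (suc i) * stirling2⁺EGF i k) (ι (2 ℕ.+ i))
      (λ k → trans (∂-expm1^*eᵗ-suc i k) (cong (λ v → ι (2 ℕ.+ i) * expm1^*eᵗ (suc i) k + ι (suc i) * v) (expm1^*eᵗ≈stirling2⁺EGF i k)))
      (∂-stirling2⁺EGF-suc i)
      (trans (trans (cong (_* eᵗ 0) (ℚP.*-zeroˡ ((expm1 Ser.^ i) 0))) (ℚP.*-zeroˡ (eᵗ 0)))
             (sym (trans (cong (_* invFact 0) (ℚP.*-zeroʳ (ι (suc i !)))) (ℚP.*-zeroˡ (invFact 0)))))

module QSeries where
  open Rationals
  open RationalSeries
  open DefsAsSeries
  open NatCombinatorics using (stirling2⁺)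
  open import Data.Nat as ℕ using (ℕ; zero; suc; _∸_)
  open import Data.Rational using (ℚ; 0ℚ; 1ℚ; _+_; _*_; _-_; -_)
  import Data.Rational.Properties as ℚP
  open import Data.Rational.Solver using (module +-*-Solver)
  import Algebra.Properties.Ring as RingProperties
  open import Relation.Binary.PropositionalEquality
  open ≡-Reasoning

  X*-0 : ∀ f → (X₁ *ₚ f) 0 ≡ 0ℚ
  X*-0 f = ℚP.*-zeroˡ (f 0)

  X*-suc : ∀ f m → (X₁ *ₚ f) (suc m) ≡ f m
  X*-suc f zero = begin
    0ℚ * f 1 + 1ℚ * f 0  ≡⟨ cong (_+ 1ℚ * f 0) (ℚP.*-zeroˡ (f 1)) ⟩
    0ℚ + 1ℚ * f 0        ≡⟨ ℚP.+-identityˡ (1ℚ * f 0) ⟩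
    1ℚ * f 0             ≡⟨ ℚP.*-identityˡ (f 0) ⟩
    f 0                  ∎
  X*-suc f (suc m) = begin
    Σ (suc (suc m)) (λ i → X₁ i * f (suc (suc m) ∸ i))           ≡⟨ Σ-unfoldˡ (suc m) _ ⟩
    0ℚ * f (suc (suc m)) + Σ (suc m) (λ i → X₁ (suc i) * f (suc m ∸ i))
      ≡⟨ cong (_+ Σ (suc m) (λ i → X₁ (suc i) * f (suc m ∸ i))) (ℚP.*-zeroˡ (f (suc (suc m)))) ⟩
    0ℚ + Σ (suc m) (λ i → X₁ (suc i) * f (suc m ∸ i))            ≡⟨ ℚP.+-identityˡ _ ⟩
    Σ (suc m) (λ i → X₁ (suc i) * f (suc m ∸ i))                 ≡⟨ Σ-unfoldˡ m _ ⟩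
    1ℚ * f (suc m) + Σ m (λ i → 0ℚ * f (m ∸ i))
      ≡⟨ cong₂ _+_ (ℚP.*-identityˡ (f (suc m))) (Σ-zero m _ (λ i _ → ℚP.*-zeroˡ (f (m ∸ i)))) ⟩
    f (suc m) + 0ℚ                                               ≡⟨ ℚP.+-identityʳ (f (suc m)) ⟩
    f (suc m)                                                    ∎

  linearFactor : ℕ → PSer
  linearFactor a = 1ₚ SerR.- κ (ι a) *ₚ X₁

  *linearFactor : ∀ f a m → (f *ₚ linearFactor a) m ≡ f m - ι a * (X₁ *ₚ f) m
  *linearFactor f a m = begin
    (f *ₚ (1ₚ SerR.- κ (ι a) *ₚ X₁)) m       ≡⟨ distributed m ⟩
    (f SerR.- κ (ι a) *ₚ (X₁ *ₚ f)) m        ≡⟨ cong (λ v → f m + - v) (κ-*ₚ (ι a) (X₁ *ₚ f) m) ⟩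
    f m - ι a * (X₁ *ₚ f) m                  ∎
    where
    open RingProperties SerR.ring using (x[y-z]≈xy-xz)
    distributed : f *ₚ (1ₚ SerR.- κ (ι a) *ₚ X₁) ≈ₚ f SerR.- κ (ι a) *ₚ (X₁ *ₚ f)
    distributed = SerR.trans (x[y-z]≈xy-xz f 1ₚ (κ (ι a) *ₚ X₁))
      (SerR.+-cong (SerR.*-identityʳ f)
        (SerR.-‿cong (SerComm.x∙yz≈y∙zx f (κ (ι a)) X₁)))

  stirling2⁺OGF : ℕ → PSer
  stirling2⁺OGF j m = ι (stirling2⁺ m j)

  stirling2⁺OGF-0*linearFactor : stirling2⁺OGF 0 *ₚ linearFactor 1 ≈ₚ 1ₚ
  stirling2⁺OGF-0*linearFactor zero =
    trans (*linearFactor (stirling2⁺OGF 0) 1 0) (cong (λ v → ι 1 - ι 1 * v) (X*-0 (stirling2⁺OGF 0)))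
  stirling2⁺OGF-0*linearFactor (suc m) = begin
    (stirling2⁺OGF 0 *ₚ linearFactor 1) (suc m)                     ≡⟨ *linearFactor (stirling2⁺OGF 0) 1 (suc m) ⟩
    ι (stirling2⁺ m 0) - ι 1 * (X₁ *ₚ stirling2⁺OGF 0) (suc m)      ≡⟨ cong (λ v → ι (stirling2⁺ m 0) - ι 1 * v) (X*-suc (stirling2⁺OGF 0) m) ⟩
    ι (stirling2⁺ m 0) - ι 1 * ι (stirling2⁺ m 0)                   ≡⟨ cong (λ v → ι (stirling2⁺ m 0) - v) (ℚP.*-identityˡ (ι (stirling2⁺ m 0))) ⟩
    ι (stirling2⁺ m 0) - ι (stirling2⁺ m 0)                         ≡⟨ ℚP.+-inverseʳ (ι (stirling2⁺ m 0)) ⟩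
    0ℚ                                                              ∎

  stirling2⁺OGF-suc*linearFactor : ∀ j → stirling2⁺OGF (suc j) *ₚ linearFactor (2 ℕ.+ j) ≈ₚ X₁ *ₚ stirling2⁺OGF j
  stirling2⁺OGF-suc*linearFactor j zero = begin
    (stirling2⁺OGF (suc j) *ₚ linearFactor (2 ℕ.+ j)) 0   ≡⟨ *linearFactor (stirling2⁺OGF (suc j)) (2 ℕ.+ j) 0 ⟩
    0ℚ - ι (2 ℕ.+ j) * (X₁ *ₚ stirling2⁺OGF (suc j)) 0    ≡⟨ cong (λ v → 0ℚ - ι (2 ℕ.+ j) * v) (X*-0 (stirling2⁺OGF (suc j))) ⟩
    0ℚ - ι (2 ℕ.+ j) * 0ℚ                                 ≡⟨ cong (λ v → 0ℚ - v) (ℚP.*-zeroʳ (ι (2 ℕ.+ j))) ⟩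
    0ℚ                                                    ≡⟨ sym (X*-0 (stirling2⁺OGF j)) ⟩
    (X₁ *ₚ stirling2⁺OGF j) 0                             ∎
  stirling2⁺OGF-suc*linearFactor j (suc m) = begin
    (stirling2⁺OGF (suc j) *ₚ linearFactor (2 ℕ.+ j)) (suc m)
      ≡⟨ *linearFactor (stirling2⁺OGF (suc j)) (2 ℕ.+ j) (suc m) ⟩
    ι (stirling2⁺ (suc m) (suc j)) - ι (2 ℕ.+ j) * (X₁ *ₚ stirling2⁺OGF (suc j)) (suc m)
      ≡⟨ cong (λ v → ι (stirling2⁺ (suc m) (suc j)) - ι (2 ℕ.+ j) * v) (X*-suc (stirling2⁺OGF (suc j)) m) ⟩
    ι (stirling2⁺ m j ℕ.+ (2 ℕ.+ j) ℕ.* d) - ι (2 ℕ.+ j) * ι d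
      ≡⟨ cong (_- ι (2 ℕ.+ j) * ι d) (trans (ι-+ (stirling2⁺ m j) _) (cong (ι (stirling2⁺ m j) +_) (ι-* (2 ℕ.+ j) d))) ⟩
    ι (stirling2⁺ m j) + ι (2 ℕ.+ j) * ι d - ι (2 ℕ.+ j) * ι d
      ≡⟨ solve 2 (λ a b → a :+ b :- b := a) refl (ι (stirling2⁺ m j)) (ι (2 ℕ.+ j) * ι d) ⟩
    ι (stirling2⁺ m j)
      ≡⟨ sym (X*-suc (stirling2⁺OGF j) m) ⟩
    (X₁ *ₚ stirling2⁺OGF j) (suc m) ∎
    where
    open +-*-Solver using (solve; _:+_; _:-_; _:=_)
    d : ℕ
    d = stirling2⁺ m (suc j)

  prodOneMinus-suc : ∀ p → prodOneMinus (suc p) ≈ₚ prodOneMinus p *ₚ linearFactor (suc p)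
  prodOneMinus-suc p = *₁≈*ₚ {prodOneMinus p} (λ _ → refl) (-₁≈- (const₁≈κ 1ℚ) (·₁≈κ*ₚ (ι (suc p)) {X₁} (λ _ → refl)))

  prodOneMinus-0 : ∀ p → prodOneMinus p 0 ≡ 1ℚ
  prodOneMinus-0 zero = refl
  prodOneMinus-0 (suc p) = begin
    prodOneMinus (suc p) 0                   ≡⟨ prodOneMinus-suc p 0 ⟩
    prodOneMinus p 0 * linearFactor (suc p) 0 ≡⟨ cong (_* linearFactor (suc p) 0) (prodOneMinus-0 p) ⟩
    1ℚ * linearFactor (suc p) 0               ≡⟨ ℚP.*-identityˡ (linearFactor (suc p) 0) ⟩
    1ℚ - (κ (ι (suc p)) *ₚ X₁) 0              ≡⟨ cong (λ q → 1ℚ - q) (trans (κ-*ₚ (ι (suc p)) X₁ 0) (ℚP.*-zeroʳ (ι (suc p)))) ⟩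
    1ℚ                                        ∎

  stirling2⁺OGF*prodOneMinus : ∀ j → stirling2⁺OGF j *ₚ prodOneMinus (suc j) ≈ₚ X₁ Ser.^ j
  stirling2⁺OGF*prodOneMinus zero = SerReasoning.begin
    s₀ *ₚ prodOneMinus 1           SerReasoning.≈⟨ *ₚ-congˡ s₀ (prodOneMinus-suc 0) ⟩
    s₀ *ₚ (const₁ 1ℚ *ₚ linearFactor 1) SerReasoning.≈⟨ *ₚ-congˡ s₀ (SerR.trans (*ₚ-congʳ (linearFactor 1) (const₁≈κ 1ℚ)) (SerR.*-identityˡ (linearFactor 1))) ⟩
    s₀ *ₚ linearFactor 1           SerReasoning.≈⟨ stirling2⁺OGF-0*linearFactor ⟩
    1ₚ                             SerReasoning.∎
    where
    s₀ : PSer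
    s₀ = stirling2⁺OGF 0
  stirling2⁺OGF*prodOneMinus (suc j) = SerReasoning.begin
    s *ₚ prodOneMinus (2 ℕ.+ j)                    SerReasoning.≈⟨ *ₚ-congˡ s (prodOneMinus-suc (suc j)) ⟩
    s *ₚ (P *ₚ linearFactor (2 ℕ.+ j))
      SerReasoning.≈⟨ SerComm.x∙yz≈xz∙y s P (linearFactor (2 ℕ.+ j)) ⟩
    (s *ₚ linearFactor (2 ℕ.+ j)) *ₚ P             SerReasoning.≈⟨ *ₚ-congʳ P (stirling2⁺OGF-suc*linearFactor j) ⟩
    (X₁ *ₚ stirling2⁺OGF j) *ₚ P                   SerReasoning.≈⟨ SerR.*-assoc X₁ (stirling2⁺OGF j) P ⟩
    X₁ *ₚ (stirling2⁺OGF j *ₚ P)                   SerReasoning.≈⟨ *ₚ-congˡ X₁ (stirling2⁺OGF*prodOneMinus j) ⟩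
    X₁ *ₚ X₁ Ser.^ j                               SerReasoning.∎
    where
    s P : PSer
    s = stirling2⁺OGF (suc j)
    P = prodOneMinus (suc j)

  Q≈stirling2⁺OGF : ∀ j → Q j ≈ₚ stirling2⁺OGF j
  Q≈stirling2⁺OGF j = SerReasoning.begin
    Q j                           SerReasoning.≈⟨ *₁≈*ₚ (^₁≈^ (λ _ → refl) j) (inv₁≈inv (λ _ → refl)) ⟩
    X₁ Ser.^ j *ₚ inv P           SerReasoning.≈⟨ *ₚ-congʳ (inv P) (SerR.sym (stirling2⁺OGF*prodOneMinus j)) ⟩
    (s *ₚ P) *ₚ inv P             SerReasoning.≈⟨ SerR.*-assoc s P (inv P) ⟩
    s *ₚ (P *ₚ inv P)             SerReasoning.≈⟨ *ₚ-congˡ s (*ₚ-inv P (prodOneMinus-0 (suc j))) ⟩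
    s *ₚ 1ₚ                       SerReasoning.≈⟨ SerR.*-identityʳ s ⟩
    s                             SerReasoning.∎
    where
    s P : PSer
    s = stirling2⁺OGF j
    P = prodOneMinus (suc j)

module ClosedForm where
  open Rationals
  open RationalSeries
  open RisingFactorialSeries ℚ-ring using (risingTerm; risingSum; risingTerm-summable; risingSum*[1-u]^suc)
  open DefsAsSeries
  open StirlingIdentities
  open ExpPowers
  open NatCombinatorics
  open import Data.Nat as ℕ using (ℕ; zero; suc; _!; _<_; s≤s)
  import Data.Nat.Properties as ℕP
  open import Data.Integer as ℤ using (+_)
  open import Data.Rational using (ℚ; 1ℚ; _*_; -_)
  import Data.Rational.Properties as ℚP
  open import Data.Rational.Solver using (module +-*-Solver)
  open import Relation.Binary.PropositionalEquality
  open ≡-Reasoning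
  open SerSolver using () renaming (solve to solveₚ; _:*_ to _⊛_; _:=_ to _⊜ₚ_)

  κι : ℕ → PSer
  κι n = κ (ι n)

  z : PSer
  z = 1ₚ SerR.- e⁻ᵗ

  z-order : Order≥ 1 z
  z-order zero _ = refl
  z-order (suc k) (s≤s ())

  z^ : ℕ → PSer
  z^ a = z Ser.^ a

  z^-summable : ∀ (c : ℕ → ℚ) → Summable (λ a → κ (c a) *ₚ z^ a)
  z^-summable c a = Order≥-*ˡ a (κ (c a)) (z^ a) (Order≥-^ z z-order a)

  -- Li_{-L}(z)/z = Σ_a (a+1)^L z^a at z = 1 - e^{-t}
  LiNeg : ℕ → PSer
  LiNeg L = Σ∞ (λ a → κι (suc a ℕ.^ L) *ₚ z^ a)

  LiOverZComposed≈LiNeg : ∀ L → LiOverZComposed (ℤ.- (+ L)) ≈ₚ LiNeg L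
  LiOverZComposed≈LiNeg L N =
    trans (sumTo≡Σ N _) (Σ-cong N (λ a → trans (cong₂ _*_ (sucPowNeg≡ι a L) (^₁≈^ (-₁≈- (const₁≈κ 1ℚ) (λ _ → refl)) a N))
                                                (sym (κ-*ₚ (ι (suc a ℕ.^ L)) (z^ a) N))))
    where
    sucPowNeg≡ι : ∀ a L → sucPowNeg a (ℤ.- (+ L)) ≡ ι (suc a ℕ.^ L)
    sucPowNeg≡ι a zero    = refl
    sucPowNeg≡ι a (suc p) = sym (ι-^ (suc a) (suc p))

  e⁻ⁿᵗ : ℕ → PSer
  e⁻ⁿᵗ n = expSeries (- ι n)

  stirlingLi : ℕ → ℕ → PSer
  stirlingLi l n = Ser.Σ n (λ j → κι (stirling1 n j) *ₚ LiNeg (l ℕ.+ j))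

  scrB≡coeff : ∀ m l n → scrB m l n ≡ ι (m !) * (e⁻ⁿᵗ n *ₚ stirlingLi l n) m
  scrB≡coeff m l n = begin
    scrB m l n
      ≡⟨ sumTo≡Σ n _ ⟩
    Σ n (λ j → ι (stirling1 n j) * (ι (m !) * (e⁻ⁿᵗ n *₁ LiOverZComposed (ℤ.- (+ (l ℕ.+ j)))) m))
      ≡⟨ Σ-cong n reorder ⟩
    Σ n (λ j → ι (m !) * (e⁻ⁿᵗ n *ₚ (κι (stirling1 n j) *ₚ LiNeg (l ℕ.+ j))) m)
      ≡⟨ sym (Σ-*ˡ n (ι (m !)) _) ⟩
    ι (m !) * Σ n (λ j → (e⁻ⁿᵗ n *ₚ (κι (stirling1 n j) *ₚ LiNeg (l ℕ.+ j))) m)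
      ≡⟨ cong (ι (m !) *_) (sym (trans (Ser.Σ-*ˡ n (e⁻ⁿᵗ n) _ m) (Σ-coeff n _ m))) ⟩
    ι (m !) * (e⁻ⁿᵗ n *ₚ stirlingLi l n) m ∎
    where
    reorder : ∀ j → ι (stirling1 n j) * (ι (m !) * (e⁻ⁿᵗ n *₁ LiOverZComposed (ℤ.- (+ (l ℕ.+ j)))) m) ≡
                    ι (m !) * (e⁻ⁿᵗ n *ₚ (κι (stirling1 n j) *ₚ LiNeg (l ℕ.+ j))) m
    reorder j = begin
      s * (ι (m !) * (e⁻ⁿᵗ n *₁ LiOverZComposed (ℤ.- (+ (l ℕ.+ j)))) m)
        ≡⟨ cong (λ v → s * (ι (m !) * v)) (*₁≈*ₚ {e⁻ⁿᵗ n} (λ _ → refl) (LiOverZComposed≈LiNeg (l ℕ.+ j)) m) ⟩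
      s * (ι (m !) * (e⁻ⁿᵗ n *ₚ L) m)
        ≡⟨ ℚ*.x∙yz≈y∙xz s (ι (m !)) _ ⟩
      ι (m !) * (s * (e⁻ⁿᵗ n *ₚ L) m)
        ≡⟨ cong (ι (m !) *_) (sym (κ-*ₚ s (e⁻ⁿᵗ n *ₚ L) m)) ⟩
      ι (m !) * (κ s *ₚ (e⁻ⁿᵗ n *ₚ L)) m
        ≡⟨ cong (ι (m !) *_) (SerComm.x∙yz≈y∙xz (κ s) (e⁻ⁿᵗ n) L m) ⟩
      ι (m !) * (e⁻ⁿᵗ n *ₚ (κ s *ₚ L)) m ∎
      where
      s : ℚ
      s = ι (stirling1 n j)
      L : PSer
      L = LiNeg (l ℕ.+ j)

  risingFallingSum : ℕ → ℕ → PSer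
  risingFallingSum n i = Σ∞ (λ a → κι (falling a i ℕ.* rising (suc a) n) *ₚ z^ a)

  weight : ℕ → ℕ → ℕ → ℕ
  weight l n a = suc a ℕ.^ l ℕ.* rising (suc a) n

  stirlingLi≈Σ∞weight : ∀ l n → stirlingLi l n ≈ₚ Σ∞ (λ a → κι (weight l n a) *ₚ z^ a)
  stirlingLi≈Σ∞weight l n = SerReasoning.begin
    stirlingLi l n
      SerReasoning.≈⟨ Ser.Σ-cong n (λ j → Σ∞-*ˡ (κι (stirling1 n j)) _ (z^-summable (λ a → ι (suc a ℕ.^ (l ℕ.+ j))))) ⟩
    Ser.Σ n (λ j → Σ∞ (λ a → κι (stirling1 n j) *ₚ (κι (suc a ℕ.^ (l ℕ.+ j)) *ₚ z^ a)))
      SerReasoning.≈⟨ SerR.sym (Σ∞-Σ n (λ j a → κι (stirling1 n j) *ₚ (κι (suc a ℕ.^ (l ℕ.+ j)) *ₚ z^ a))) ⟩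
    Σ∞ (λ a → Ser.Σ n (λ j → κι (stirling1 n j) *ₚ (κι (suc a ℕ.^ (l ℕ.+ j)) *ₚ z^ a)))
      SerReasoning.≈⟨ Σ∞-cong (λ a → Σ-κ*κ* n _ _ (z^ a)) ⟩
    Σ∞ (λ a → κ (Σ n (λ j → ι (stirling1 n j) * ι (suc a ℕ.^ (l ℕ.+ j)))) *ₚ z^ a)
      SerReasoning.≈⟨ Σ∞-cong (λ a → *ₚ-congʳ (z^ a) (κ-cong (Σstirling1*^[l+]≡^*rising (suc a) l n))) ⟩
    Σ∞ (λ a → κι (weight l n a) *ₚ z^ a) SerReasoning.∎

  ι-weight : ∀ l n a → ι (weight l n a) ≡ Σ l (λ i → ι (stirling2⁺ l i) * ι (falling a i ℕ.* rising (suc a) n))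
  ι-weight l n a = begin
    ι (suc a ℕ.^ l ℕ.* rising (suc a) n)                                   ≡⟨ ι-* (suc a ℕ.^ l) _ ⟩
    ι (suc a ℕ.^ l) * ι (rising (suc a) n)                                 ≡⟨ cong (_* ι (rising (suc a) n)) (suc^≡Σstirling2⁺*falling a l) ⟩
    Σ l (λ i → ι (stirling2⁺ l i ℕ.* falling a i)) * ι (rising (suc a) n)  ≡⟨ Σ-*ʳ l _ _ ⟩
    Σ l (λ i → ι (stirling2⁺ l i ℕ.* falling a i) * ι (rising (suc a) n))  ≡⟨ Σ-cong l regroup ⟩
    Σ l (λ i → ι (stirling2⁺ l i) * ι (falling a i ℕ.* rising (suc a) n))  ∎
    where
    regroup : ∀ i → ι (stirling2⁺ l i ℕ.* falling a i) * ι (rising (suc a) n) ≡ ι (stirling2⁺ l i) * ι (falling a i ℕ.* rising (suc a) n)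
    regroup i = begin
      ι (stirling2⁺ l i ℕ.* falling a i) * ι (rising (suc a) n)      ≡⟨ sym (ι-* (stirling2⁺ l i ℕ.* falling a i) _) ⟩
      ι (stirling2⁺ l i ℕ.* falling a i ℕ.* rising (suc a) n)        ≡⟨ cong ι (ℕP.*-assoc (stirling2⁺ l i) (falling a i) _) ⟩
      ι (stirling2⁺ l i ℕ.* (falling a i ℕ.* rising (suc a) n))      ≡⟨ ι-* (stirling2⁺ l i) _ ⟩
      ι (stirling2⁺ l i) * ι (falling a i ℕ.* rising (suc a) n)      ∎

  Σ∞weight≈Σ : ∀ l n → Σ∞ (λ a → κι (weight l n a) *ₚ z^ a) ≈ₚ Ser.Σ l (λ i → κι (stirling2⁺ l i) *ₚ risingFallingSum n i)
  Σ∞weight≈Σ l n = SerReasoning.begin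
    Σ∞ (λ a → κι (weight l n a) *ₚ z^ a)
      SerReasoning.≈⟨ Σ∞-cong (λ a → *ₚ-congʳ (z^ a) (κ-cong (ι-weight l n a))) ⟩
    Σ∞ (λ a → κ (Σ l (λ i → ι (stirling2⁺ l i) * ι (falling a i ℕ.* rising (suc a) n))) *ₚ z^ a)
      SerReasoning.≈⟨ Σ∞-cong (λ a → SerR.sym (Σ-κ*κ* l _ _ (z^ a))) ⟩
    Σ∞ (λ a → Ser.Σ l (λ i → κι (stirling2⁺ l i) *ₚ (κι (falling a i ℕ.* rising (suc a) n) *ₚ z^ a)))
      SerReasoning.≈⟨ Σ∞-Σ l (λ i a → κι (stirling2⁺ l i) *ₚ (κι (falling a i ℕ.* rising (suc a) n) *ₚ z^ a)) ⟩
    Ser.Σ l (λ i → Σ∞ (λ a → κι (stirling2⁺ l i) *ₚ (κι (falling a i ℕ.* rising (suc a) n) *ₚ z^ a)))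
      SerReasoning.≈⟨ Ser.Σ-cong l (λ i → SerR.sym (Σ∞-*ˡ (κι (stirling2⁺ l i)) _ (z^-summable (λ a → ι (falling a i ℕ.* rising (suc a) n))))) ⟩
    Ser.Σ l (λ i → κι (stirling2⁺ l i) *ₚ risingFallingSum n i) SerReasoning.∎

  -- The terms with a < i vanish, and for a = b + i the weight a(a-1)⋯(a-i+1)·(a+1)⋯(a+n)
  -- is (b+1)⋯(b+i+n).
  risingFallingSum≈z^*risingSum : ∀ n i → risingFallingSum n i ≈ₚ z^ i *ₚ risingSum z z-order (i ℕ.+ n)
  risingFallingSum≈z^*risingSum n i = SerReasoning.begin
    risingFallingSum n i
      SerReasoning.≈⟨ Σ∞-shift i _ (z^-summable (λ a → ι (falling a i ℕ.* rising (suc a) n))) vanishing ⟩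
    Σ∞ (λ b → κι (falling (b ℕ.+ i) i ℕ.* rising (suc (b ℕ.+ i)) n) *ₚ z^ (b ℕ.+ i))
      SerReasoning.≈⟨ Σ∞-cong shifted ⟩
    Σ∞ (λ b → z^ i *ₚ risingTerm z z-order (i ℕ.+ n) b)
      SerReasoning.≈⟨ SerR.sym (Σ∞-*ˡ (z^ i) _ (risingTerm-summable z z-order (i ℕ.+ n))) ⟩
    z^ i *ₚ risingSum z z-order (i ℕ.+ n) SerReasoning.∎
    where
    vanishing : ∀ a → a < i → κι (falling a i ℕ.* rising (suc a) n) *ₚ z^ a ≈ₚ 0ₚ
    vanishing a a<i k = trans (κ-*ₚ _ (z^ a) k)
      (trans (cong (λ v → ι (v ℕ.* rising (suc a) n) * z^ a k) (falling-vanishes a i a<i)) (ℚP.*-zeroˡ (z^ a k)))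
    shifted : ∀ b → κι (falling (b ℕ.+ i) i ℕ.* rising (suc (b ℕ.+ i)) n) *ₚ z^ (b ℕ.+ i) ≈ₚ z^ i *ₚ risingTerm z z-order (i ℕ.+ n) b
    shifted b = SerReasoning.begin
      κι (falling (b ℕ.+ i) i ℕ.* rising (suc (b ℕ.+ i)) n) *ₚ z^ (b ℕ.+ i)
        SerReasoning.≈⟨ *ₚ-cong (κ-cong (trans (cong ι (falling*rising b i n)) (sym (fromℕ≡ι (rising (suc b) (i ℕ.+ n))))))
                                (Ser.^-homo-* z b i) ⟩
      κ (fromℕ (rising (suc b) (i ℕ.+ n))) *ₚ (z^ b *ₚ z^ i)
        SerReasoning.≈⟨ SerComm.x∙yz≈z∙xy (κ (fromℕ (rising (suc b) (i ℕ.+ n)))) (z^ b) (z^ i) ⟩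
      z^ i *ₚ risingTerm z z-order (i ℕ.+ n) b SerReasoning.∎

  z*eᵗ≈expm1 : z *ₚ eᵗ ≈ₚ expm1
  z*eᵗ≈expm1 = SerReasoning.begin
    (1ₚ SerR.- e⁻ᵗ) *ₚ eᵗ            SerReasoning.≈⟨ [y-z]x≈yx-zx eᵗ 1ₚ e⁻ᵗ ⟩
    1ₚ *ₚ eᵗ SerR.- e⁻ᵗ *ₚ eᵗ        SerReasoning.≈⟨ SerR.+-cong (SerR.*-identityˡ eᵗ) (SerR.-‿cong e⁻ᵗ*eᵗ) ⟩
    expm1                            SerReasoning.∎
    where open import Algebra.Properties.Ring SerR.ring using ([y-z]x≈yx-zx)

  risingSum-z : ∀ K → risingSum z z-order K ≈ₚ κι (K !) *ₚ eᵗ Ser.^ suc K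
  risingSum-z K = SerReasoning.begin
    T                                              SerReasoning.≈⟨ SerR.sym (SerR.*-identityʳ T) ⟩
    T *ₚ 1ₚ                                        SerReasoning.≈⟨ *ₚ-congˡ T (SerR.sym e⁻ᵗ^*eᵗ^) ⟩
    T *ₚ (e⁻ᵗ Ser.^ suc K *ₚ eᵗ Ser.^ suc K)       SerReasoning.≈⟨ SerR.sym (SerR.*-assoc T (e⁻ᵗ Ser.^ suc K) (eᵗ Ser.^ suc K)) ⟩
    (T *ₚ e⁻ᵗ Ser.^ suc K) *ₚ eᵗ Ser.^ suc K       SerReasoning.≈⟨ *ₚ-congʳ (eᵗ Ser.^ suc K) (*ₚ-congˡ T (Ser.^-congˡ (suc K) (SerR.sym 1-z≈e⁻ᵗ))) ⟩
    (T *ₚ (1ₚ SerR.- z) Ser.^ suc K) *ₚ eᵗ Ser.^ suc K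
                                                   SerReasoning.≈⟨ *ₚ-congʳ (eᵗ Ser.^ suc K) (risingSum*[1-u]^suc z z-order K) ⟩
    κ (fromℕ (K !)) *ₚ eᵗ Ser.^ suc K              SerReasoning.≈⟨ *ₚ-congʳ (eᵗ Ser.^ suc K) (κ-cong (fromℕ≡ι (K !))) ⟩
    κι (K !) *ₚ eᵗ Ser.^ suc K                     SerReasoning.∎
    where
    T : PSer
    T = risingSum z z-order K
    1-z≈e⁻ᵗ : 1ₚ SerR.- z ≈ₚ e⁻ᵗ
    1-z≈e⁻ᵗ k = solve 2 (λ o x → o :+ :- (o :+ :- x) := x) refl (1ₚ k) (e⁻ᵗ k)
      where open +-*-Solver using (solve; _:+_; :-_; _:=_)
    e⁻ᵗ^*eᵗ^ : e⁻ᵗ Ser.^ suc K *ₚ eᵗ Ser.^ suc K ≈ₚ 1ₚ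
    e⁻ᵗ^*eᵗ^ = SerR.trans (SerR.sym (Ser.^-distrib-* e⁻ᵗ eᵗ (suc K)))
                          (SerR.trans (Ser.^-congˡ (suc K) e⁻ᵗ*eᵗ) (Ser.1^n≈1 (suc K)))

  e⁻ⁿᵗ*risingFallingSum : ∀ n i → e⁻ⁿᵗ n *ₚ risingFallingSum n i ≈ₚ κι ((i ℕ.+ n) !) *ₚ expm1^*eᵗ i
  e⁻ⁿᵗ*risingFallingSum n i = SerReasoning.begin
    e⁻ⁿᵗ n *ₚ risingFallingSum n i
      SerReasoning.≈⟨ *ₚ-congˡ (e⁻ⁿᵗ n) (SerR.trans (risingFallingSum≈z^*risingSum n i) (*ₚ-congˡ (z^ i) (risingSum-z (i ℕ.+ n)))) ⟩
    e⁻ⁿᵗ n *ₚ (z^ i *ₚ (c *ₚ eᵗ Ser.^ suc (i ℕ.+ n)))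
      SerReasoning.≈⟨ *ₚ-congˡ (e⁻ⁿᵗ n) (*ₚ-congˡ (z^ i) (*ₚ-congˡ c (*ₚ-congˡ eᵗ (Ser.^-homo-* eᵗ i n)))) ⟩
    e⁻ⁿᵗ n *ₚ (z^ i *ₚ (c *ₚ (eᵗ *ₚ (eᵗ Ser.^ i *ₚ eᵗ Ser.^ n))))
      SerReasoning.≈⟨ solveₚ 6 (λ en zi k e ei enn → en ⊛ (zi ⊛ (k ⊛ (e ⊛ (ei ⊛ enn)))) ⊜ₚ k ⊛ ((en ⊛ enn) ⊛ ((zi ⊛ ei) ⊛ e)))
                      SerR.refl (e⁻ⁿᵗ n) (z^ i) c eᵗ (eᵗ Ser.^ i) (eᵗ Ser.^ n) ⟩
    c *ₚ ((e⁻ⁿᵗ n *ₚ eᵗ Ser.^ n) *ₚ ((z^ i *ₚ eᵗ Ser.^ i) *ₚ eᵗ))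
      SerReasoning.≈⟨ *ₚ-congˡ c (*ₚ-cong (exp-neg*eᵗ^ n) (*ₚ-congʳ eᵗ (SerR.trans (SerR.sym (Ser.^-distrib-* z eᵗ i)) (Ser.^-congˡ i z*eᵗ≈expm1)))) ⟩
    c *ₚ (1ₚ *ₚ expm1^*eᵗ i)
      SerReasoning.≈⟨ *ₚ-congˡ c (SerR.*-identityˡ (expm1^*eᵗ i)) ⟩
    c *ₚ expm1^*eᵗ i SerReasoning.∎
    where
    c : PSer
    c = κι ((i ℕ.+ n) !)

  scrB-closedForm : ∀ m l n → scrB m l n ≡ Σ l (λ i → ι (i ! ℕ.* (i ℕ.+ n) !) * (ι (stirling2⁺ l i) * ι (stirling2⁺ m i)))
  scrB-closedForm m l n = begin
    scrB m l n
      ≡⟨ scrB≡coeff m l n ⟩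
    ι (m !) * (e⁻ⁿᵗ n *ₚ stirlingLi l n) m
      ≡⟨ cong (ι (m !) *_) (*ₚ-congˡ (e⁻ⁿᵗ n) (SerR.trans (stirlingLi≈Σ∞weight l n) (Σ∞weight≈Σ l n)) m) ⟩
    ι (m !) * (e⁻ⁿᵗ n *ₚ Ser.Σ l (λ i → κι (stirling2⁺ l i) *ₚ risingFallingSum n i)) m
      ≡⟨ cong (ι (m !) *_) (trans (Ser.Σ-*ˡ l (e⁻ⁿᵗ n) _ m) (Σ-coeff l _ m)) ⟩
    ι (m !) * Σ l (λ i → (e⁻ⁿᵗ n *ₚ (κι (stirling2⁺ l i) *ₚ risingFallingSum n i)) m)
      ≡⟨ Σ-*ˡ l (ι (m !)) _ ⟩
    Σ l (λ i → ι (m !) * (e⁻ⁿᵗ n *ₚ (κι (stirling2⁺ l i) *ₚ risingFallingSum n i)) m)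
      ≡⟨ Σ-cong l term ⟩
    Σ l (λ i → ι (i ! ℕ.* (i ℕ.+ n) !) * (ι (stirling2⁺ l i) * ι (stirling2⁺ m i))) ∎
    where
    term : ∀ i → ι (m !) * (e⁻ⁿᵗ n *ₚ (κι (stirling2⁺ l i) *ₚ risingFallingSum n i)) m ≡
                 ι (i ! ℕ.* (i ℕ.+ n) !) * (ι (stirling2⁺ l i) * ι (stirling2⁺ m i))
    term i = begin
      ι (m !) * (e⁻ⁿᵗ n *ₚ (κι S *ₚ risingFallingSum n i)) m
        ≡⟨ cong (ι (m !) *_) (SerComm.x∙yz≈y∙xz (e⁻ⁿᵗ n) (κι S) (risingFallingSum n i) m) ⟩
      ι (m !) * (κι S *ₚ (e⁻ⁿᵗ n *ₚ risingFallingSum n i)) m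
        ≡⟨ cong (ι (m !) *_) (*ₚ-congˡ (κι S) (SerR.trans (e⁻ⁿᵗ*risingFallingSum n i) (*ₚ-congˡ (κι ((i ℕ.+ n) !)) (expm1^*eᵗ≈stirling2⁺EGF i))) m) ⟩
      ι (m !) * (κι S *ₚ (κι ((i ℕ.+ n) !) *ₚ stirling2⁺EGF i)) m
        ≡⟨ cong (ι (m !) *_) (trans (κ-*ₚ (ι S) (κι ((i ℕ.+ n) !) *ₚ stirling2⁺EGF i) m) (cong (ι S *_) (κ-*ₚ (ι ((i ℕ.+ n) !)) (stirling2⁺EGF i) m))) ⟩
      ι (m !) * (ι S * (ι ((i ℕ.+ n) !) * (ι (i !) * ι (stirling2⁺ m i) * invFact m)))
        ≡⟨ solve 6 (λ M a b f s v → M :* (a :* (b :* (f :* s :* v))) := f :* b :* (a :* s) :* (v :* M)) refl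
                   (ι (m !)) (ι S) (ι ((i ℕ.+ n) !)) (ι (i !)) (ι (stirling2⁺ m i)) (invFact m) ⟩
      ι (i !) * ι ((i ℕ.+ n) !) * (ι S * ι (stirling2⁺ m i)) * (invFact m * ι (m !))
        ≡⟨ cong₂ (λ u v → u * (ι S * ι (stirling2⁺ m i)) * v) (sym (ι-* (i !) ((i ℕ.+ n) !))) (invFact*! m) ⟩
      ι (i ! ℕ.* (i ℕ.+ n) !) * (ι S * ι (stirling2⁺ m i)) * 1ℚ
        ≡⟨ ℚP.*-identityʳ _ ⟩
      ι (i ! ℕ.* (i ℕ.+ n) !) * (ι S * ι (stirling2⁺ m i)) ∎
      where
      open +-*-Solver using (solve; _:*_; _:=_)
      S : ℕ
      S = stirling2⁺ l i

module OrdinaryGF where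
  open Rationals
  open RationalSeries
  open DefsAsSeries
  open QSeries
  open ClosedForm using (scrB-closedForm)
  open NatCombinatorics using (stirling2⁺; stirling2⁺-vanishes)
  open import Data.Nat as ℕ using (ℕ; _!; _<_)
  open import Data.Rational using (0ℚ; _*_)
  import Data.Rational.Properties as ℚP
  open import Relation.Binary.PropositionalEquality
  open ≡-Reasoning

  ordinaryGF : ∀ n l m → lhsOrd n l m ≡ rhsOrd n l m
  ordinaryGF n l m = begin
    scrB m l n
      ≡⟨ scrB-closedForm m l n ⟩
    Σ l (λ j → c j * (ι (stirling2⁺ l j) * ι (stirling2⁺ m j)))
      ≡⟨ sym (Σ-extend l m _ vanishing) ⟩
    Σ (l ℕ.+ m) (λ j → c j * (ι (stirling2⁺ l j) * ι (stirling2⁺ m j)))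
      ≡⟨ Σ-cong (l ℕ.+ m) (λ j → cong (c j *_) (sym (cong₂ _*_ (Q≈stirling2⁺OGF j l) (Q≈stirling2⁺OGF j m)))) ⟩
    Σ (l ℕ.+ m) (λ j → c j * tensor (Q j) (Q j) l m)
      ≡⟨ sym (sumTo≡Σ (l ℕ.+ m) _) ⟩
    rhsOrd n l m ∎
    where
    c : ℕ → _
    c j = ι (j ! ℕ.* (j ℕ.+ n) !)
    vanishing : ∀ j → l < j → c j * (ι (stirling2⁺ l j) * ι (stirling2⁺ m j)) ≡ 0ℚ
    vanishing j l<j = begin
      c j * (ι (stirling2⁺ l j) * ι (stirling2⁺ m j)) ≡⟨ cong (λ v → c j * (ι v * ι (stirling2⁺ m j))) (stirling2⁺-vanishes l j l<j) ⟩
      c j * (0ℚ * ι (stirling2⁺ m j))                 ≡⟨ cong (c j *_) (ℚP.*-zeroˡ (ι (stirling2⁺ m j))) ⟩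
      c j * 0ℚ                                        ≡⟨ ℚP.*-zeroʳ (c j) ⟩
      0ℚ                                              ∎

module TwoVariableSeries where
  open Rationals
  open RationalSeries
  open DefsAsSeries
  open import Data.Nat as ℕ using (ℕ; zero; suc; _∸_; _≤_; _<_; s≤s)
  import Data.Nat.Properties as ℕP
  open import Data.Rational using (0ℚ; 1ℚ; _+_; _*_; -_)
  import Data.Rational.Properties as ℚP
  open import Relation.Binary.PropositionalEquality
  open import Relation.Nullary using (yes; no)
  open ≡-Reasoning

  -- A series in x and y is a series in x whose coefficients are series in y.
  module XY = PowerSeries commutativeRingₚ

  infix 4 _≈₂_
  _≈₂_ : PS2 → PS2 → Set
  _≈₂_ = XY._≈ₚ_

  Σ-coeff₂ : ∀ N (F : ℕ → PS2) l m → XY.Ser.Σ N F l m ≡ Σ N (λ j → F j l m)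
  Σ-coeff₂ N F l m = trans (XY.Σ-coeff N F l m) (Σ-coeff N (λ j → F j l) m)

  *₂≈*ₚ : ∀ {F F' G G'} → F ≈₂ F' → G ≈₂ G' → F *₂ G ≈₂ F' XY.*ₚ G'
  *₂≈*ₚ {F} {F'} {G} {G'} eF eG l m = begin
    sumTo l (λ i → sumTo m (λ j → F i j * G (l ∸ i) (m ∸ j)))   ≡⟨ sumTo≡Σ l _ ⟩
    Σ l (λ i → sumTo m (λ j → F i j * G (l ∸ i) (m ∸ j)))
      ≡⟨ Σ-cong l (λ i → trans (sumTo≡Σ m _) (Σ-cong m (λ j → cong₂ _*_ (eF i j) (eG (l ∸ i) (m ∸ j))))) ⟩
    Σ l (λ i → (F' i *ₚ G' (l ∸ i)) m)                          ≡⟨ sym (Σ-coeff l _ m) ⟩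
    (F' XY.*ₚ G') l m                                           ∎

  const₂≈1 : const₂ 1ℚ ≈₂ XY.1ₚ
  const₂≈1 zero    zero    = refl
  const₂≈1 zero    (suc m) = ℚP.*-zeroʳ 1ℚ
  const₂≈1 (suc l) m       = ℚP.*-zeroˡ (const₁ 1ℚ m)

  ^₂≈^ : ∀ {F F'} → F ≈₂ F' → ∀ r → F ^₂ r ≈₂ F' XY.Ser.^ r
  ^₂≈^ e zero    = const₂≈1
  ^₂≈^ e (suc r) = *₂≈*ₚ e (^₂≈^ e r)

  -₂≈- : ∀ {F F' G G'} → F ≈₂ F' → G ≈₂ G' → F -₂ G ≈₂ F' XY.SerR.- G'
  -₂≈- eF eG l m = cong₂ (λ a b → a + - b) (eF l m) (eG l m)

  ·₂≈κ*ₚ : ∀ a {F F'} → F ≈₂ F' → a ·₂ F ≈₂ XY.κ (κ a) XY.*ₚ F'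
  ·₂≈κ*ₚ a {F' = F'} e l m = trans (cong (a *_) (e l m)) (sym (trans (XY.κ-*ₚ (κ a) F' l m) (κ-*ₚ a (F' l) m)))

  tensor-cong : ∀ {f f' g g'} → f ≈ₚ f' → g ≈ₚ g' → tensor f g ≈₂ tensor f' g'
  tensor-cong ef eg l m = cong₂ _*_ (ef l) (eg m)

  tensor-* : ∀ f₁ g₁ f₂ g₂ → tensor f₁ g₁ XY.*ₚ tensor f₂ g₂ ≈₂ tensor (f₁ *ₚ f₂) (g₁ *ₚ g₂)
  tensor-* f₁ g₁ f₂ g₂ l m = begin
    (tensor f₁ g₁ XY.*ₚ tensor f₂ g₂) l m
      ≡⟨ Σ-coeff l _ m ⟩
    Σ l (λ i → (tensor f₁ g₁ i *ₚ tensor f₂ g₂ (l ∸ i)) m)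
      ≡⟨ Σ-cong l (λ i → trans (Σ-cong m (λ j → ℚ*.interchange (f₁ i) (g₁ j) (f₂ (l ∸ i)) (g₂ (m ∸ j))))
                               (sym (Σ-*ˡ m (f₁ i * f₂ (l ∸ i)) _))) ⟩
    Σ l (λ i → f₁ i * f₂ (l ∸ i) * (g₁ *ₚ g₂) m)
      ≡⟨ sym (Σ-*ʳ l ((g₁ *ₚ g₂) m) _) ⟩
    (f₁ *ₚ f₂) l * (g₁ *ₚ g₂) m ∎

  tensor-1 : tensor 1ₚ 1ₚ ≈₂ XY.1ₚ
  tensor-1 zero    zero    = refl
  tensor-1 zero    (suc m) = ℚP.*-zeroʳ 1ℚ
  tensor-1 (suc l) m       = ℚP.*-zeroˡ (1ₚ m)

  tensor-^ : ∀ f g r → tensor f g XY.Ser.^ r ≈₂ tensor (f Ser.^ r) (g Ser.^ r)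
  tensor-^ f g zero    l m = sym (tensor-1 l m)
  tensor-^ f g (suc r) l m = trans (XY.*ₚ-congˡ (tensor f g) (tensor-^ f g r) l m) (tensor-* f g (f Ser.^ r) (g Ser.^ r) l m)

  TotalOrder≥ : ℕ → PS2 → Set
  TotalOrder≥ d F = ∀ l m → l ℕ.+ m < d → F l m ≡ 0ℚ

  TotalOrder≥-* : ∀ a b F G → TotalOrder≥ a F → TotalOrder≥ b G → TotalOrder≥ (a ℕ.+ b) (F XY.*ₚ G)
  TotalOrder≥-* a b F G oF oG l m l+m<a+b =
    trans (Σ-coeff l _ m) (Σ-zero l _ (λ i i≤l → Σ-zero m _ (λ j j≤m → term i j i≤l j≤m)))
    where
    open import Algebra.Properties.CommutativeSemigroup ℕP.+-commutativeSemigroup using (interchange)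
    term : ∀ i j → i ≤ l → j ≤ m → F i j * G (l ∸ i) (m ∸ j) ≡ 0ℚ
    term i j i≤l j≤m with (i ℕ.+ j) ℕP.<? a
    ... | yes i+j<a = trans (cong (_* G (l ∸ i) (m ∸ j)) (oF i j i+j<a)) (ℚP.*-zeroˡ (G (l ∸ i) (m ∸ j)))
    ... | no i+j≮a = trans (cong (F i j *_) (oG (l ∸ i) (m ∸ j) rest<b)) (ℚP.*-zeroʳ (F i j))
      where
      split : (i ℕ.+ j) ℕ.+ ((l ∸ i) ℕ.+ (m ∸ j)) ≡ l ℕ.+ m
      split = trans (interchange i j (l ∸ i) (m ∸ j))
                    (cong₂ ℕ._+_ (ℕP.m+[n∸m]≡n i≤l) (ℕP.m+[n∸m]≡n j≤m))
      rest<b : (l ∸ i) ℕ.+ (m ∸ j) < b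
      rest<b = ℕP.+-cancelˡ-< (i ℕ.+ j) _ b
                 (subst (_< (i ℕ.+ j) ℕ.+ b) (sym split) (ℕP.<-≤-trans l+m<a+b (ℕP.+-monoˡ-≤ b (ℕP.≮⇒≥ i+j≮a))))

  TotalOrder≥-^ : ∀ H → TotalOrder≥ 1 H → ∀ r → TotalOrder≥ r (H XY.Ser.^ r)
  TotalOrder≥-^ H o zero    l m ()
  TotalOrder≥-^ H o (suc r) = TotalOrder≥-* 1 r H (H XY.Ser.^ r) o (TotalOrder≥-^ H o r)

  *₂-inv₂ : ∀ F → F 0 0 ≡ 1ℚ → F *₂ inv₂ F ≈₂ const₂ 1ℚ
  *₂-inv₂ F F00≡1 l m = begin
    (F *₂ inv₂ F) l m
      ≡⟨ *₂≈*ₚ {F} {F} {inv₂ F} {inv₂ F} (λ _ _ → refl) (λ _ _ → refl) l m ⟩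
    (F XY.*ₚ inv₂ F) l m
      ≡⟨ Σ-coeff l _ m ⟩
    Σ l (λ i → Σ m (λ j → F i j * inv₂ F (l ∸ i) (m ∸ j)))
      ≡⟨ Σ-cong≤ l (λ i i≤ → Σ-cong≤ m (λ j j≤ → cong (F i j *_) (inv₂≈S (l ∸ i) (m ∸ j) (ℕP.+-mono-≤ (ℕP.m∸n≤m l i) (ℕP.m∸n≤m m j))))) ⟩
    Σ l (λ i → Σ m (λ j → F i j * S (l ∸ i) (m ∸ j)))
      ≡⟨ sym (Σ-coeff l _ m) ⟩
    (F XY.*ₚ S) l m
      ≡⟨ sym (ℚP.+-identityʳ _) ⟩
    (F XY.*ₚ S) l m + 0ℚ
      ≡⟨ cong ((F XY.*ₚ S) l m +_) (sym (TotalOrder≥-^ H H-order (suc N) l m (ℕP.n<1+n N))) ⟩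
    (F XY.*ₚ S) l m + (H XY.Ser.^ suc N) l m
      ≡⟨ XY.Ser.geometric-inverse F N l m ⟩
    XY.1ₚ l m
      ≡⟨ sym (const₂≈1 l m) ⟩
    const₂ 1ℚ l m ∎
    where
    N : ℕ
    N = l ℕ.+ m
    H S : PS2
    H = XY.1ₚ XY.SerR.- F
    S = XY.Ser.Σ N (H XY.Ser.^_)
    H-order : TotalOrder≥ 1 H
    H-order zero    zero    _ = trans (cong (λ v → 1ℚ + - v) F00≡1) (ℚP.+-inverseʳ 1ℚ)
    H-order zero    (suc m) (s≤s ())
    H-order (suc l) m       (s≤s ())
    inv₂≈S : ∀ i j → i ℕ.+ j ≤ N → inv₂ F i j ≡ S i j
    inv₂≈S i j i+j≤N = begin
      inv₂ F i j                                        ≡⟨ sumTo≡Σ (i ℕ.+ j) _ ⟩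
      Σ (i ℕ.+ j) (λ r → ((const₂ 1ℚ -₂ F) ^₂ r) i j)   ≡⟨ Σ-cong (i ℕ.+ j) (λ r → ^₂≈^ (-₂≈- const₂≈1 (λ _ _ → refl)) r i j) ⟩
      Σ (i ℕ.+ j) (λ r → (H XY.Ser.^ r) i j)            ≡⟨ sym (Σ-extend≤ _ i+j≤N (λ r lt → TotalOrder≥-^ H H-order r i j lt)) ⟩
      Σ N (λ r → (H XY.Ser.^ r) i j)                    ≡⟨ sym (Σ-coeff₂ N _ i j) ⟩
      S i j                                             ∎

module ExponentialGF where
  open Rationals
  open RationalSeries
  open DefsAsSeries
  open TwoVariableSeries
  open ExpPowers
  open ClosedForm using (scrB-closedForm)
  open NatCombinatorics using (rising; stirling2⁺; !-split)
  open RisingFactorialSeries commutativeRingₚ using (risingTerm; risingSum; risingTerm-summable; risingSum*[1-u]^suc)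
  open import Data.Nat as ℕ using (ℕ; zero; suc; _!; s≤s)
  open import Data.Rational using (ℚ; 1ℚ; _+_; _*_; -_)
  import Data.Rational.Properties as ℚP
  open import Data.Rational.Solver using (module +-*-Solver)
  open import Relation.Binary.PropositionalEquality
  open ≡-Reasoning

  eˣ⁺ʸ U : PS2
  eˣ⁺ʸ = tensor eᵗ eᵗ
  U    = tensor expm1 expm1

  U-order : XY.Order≥ 1 U
  U-order zero    _        m = ℚP.*-zeroˡ (expm1 m)
  U-order (suc k) (s≤s ())

  Ser-fromℕ≈κι : ∀ k → Ser.fromℕ k ≈ₚ κ (ι k)
  Ser-fromℕ≈κι zero    zero    = refl
  Ser-fromℕ≈κι zero    (suc m) = refl
  Ser-fromℕ≈κι (suc k) m = trans (cong (1ₚ m +_) (Ser-fromℕ≈κι k m)) (trans (κ-+ 1ℚ (ι k) m) (cong (λ v → κ v m) (sym (ι-suc k))))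

  eˣ⁺ʸ*U^ : ∀ j → eˣ⁺ʸ XY.*ₚ U XY.Ser.^ j ≈₂ tensor (expm1^*eᵗ j) (expm1^*eᵗ j)
  eˣ⁺ʸ*U^ j l m = begin
    (eˣ⁺ʸ XY.*ₚ U XY.Ser.^ j) l m                         ≡⟨ XY.*ₚ-congˡ eˣ⁺ʸ (tensor-^ expm1 expm1 j) l m ⟩
    (eˣ⁺ʸ XY.*ₚ tensor (expm1 Ser.^ j) (expm1 Ser.^ j)) l m ≡⟨ tensor-* eᵗ eᵗ (expm1 Ser.^ j) (expm1 Ser.^ j) l m ⟩
    tensor (eᵗ *ₚ expm1 Ser.^ j) (eᵗ *ₚ expm1 Ser.^ j) l m  ≡⟨ tensor-cong (*ₚ-comm eᵗ (expm1 Ser.^ j)) (*ₚ-comm eᵗ (expm1 Ser.^ j)) l m ⟩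
    tensor (expm1^*eᵗ j) (expm1^*eᵗ j) l m                  ∎

  eˣ⁺ʸ*risingTerm : ∀ n j l m → (eˣ⁺ʸ XY.*ₚ risingTerm U U-order n j) l m ≡ ι (rising (suc j) n) * (expm1^*eᵗ j l * expm1^*eᵗ j m)
  eˣ⁺ʸ*risingTerm n j l m = begin
    (eˣ⁺ʸ XY.*ₚ (XY.κ c XY.*ₚ U^j)) l m
      ≡⟨ XY.SerComm.x∙yz≈y∙xz eˣ⁺ʸ (XY.κ c) U^j l m ⟩
    (XY.κ c XY.*ₚ (eˣ⁺ʸ XY.*ₚ U^j)) l m                    ≡⟨ XY.κ-*ₚ c (eˣ⁺ʸ XY.*ₚ U^j) l m ⟩
    (c *ₚ (eˣ⁺ʸ XY.*ₚ U^j) l) m                            ≡⟨ *ₚ-congʳ ((eˣ⁺ʸ XY.*ₚ U^j) l) (Ser-fromℕ≈κι (rising (suc j) n)) m ⟩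
    (κ (ι (rising (suc j) n)) *ₚ (eˣ⁺ʸ XY.*ₚ U^j) l) m     ≡⟨ κ-*ₚ (ι (rising (suc j) n)) ((eˣ⁺ʸ XY.*ₚ U^j) l) m ⟩
    ι (rising (suc j) n) * (eˣ⁺ʸ XY.*ₚ U^j) l m            ≡⟨ cong (ι (rising (suc j) n) *_) (eˣ⁺ʸ*U^ j l m) ⟩
    ι (rising (suc j) n) * (expm1^*eᵗ j l * expm1^*eᵗ j m) ∎
    where
    c : PSer
    c = Ser.fromℕ (rising (suc j) n)
    U^j : PS2
    U^j = U XY.Ser.^ j

  -- Since i! (i+n)! = (i+1)⋯(i+n) · i! · i!, each term of the closed form for 𝓑 factors
  -- into the coefficients of (e^x-1)^i e^x and (e^y-1)^i e^y.
  lhsExp≈eˣ⁺ʸ*risingSum : ∀ n → lhsExp n ≈₂ eˣ⁺ʸ XY.*ₚ risingSum U U-order n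
  lhsExp≈eˣ⁺ʸ*risingSum n l m = begin
    scrB m l n * invFact l * invFact m
      ≡⟨ cong (λ v → v * invFact l * invFact m) (scrB-closedForm m l n) ⟩
    Σ l (λ i → c i * (ι (stirling2⁺ l i) * ι (stirling2⁺ m i))) * invFact l * invFact m
      ≡⟨ trans (cong (_* invFact m) (Σ-*ʳ l (invFact l) _)) (Σ-*ʳ l (invFact m) _) ⟩
    Σ l (λ i → c i * (ι (stirling2⁺ l i) * ι (stirling2⁺ m i)) * invFact l * invFact m)
      ≡⟨ Σ-cong l term ⟩
    Σ l (λ j → (eˣ⁺ʸ XY.*ₚ risingTerm U U-order n j) l m)
      ≡⟨ sym (Σ-coeff l _ m) ⟩
    XY.Σ∞ (λ j → eˣ⁺ʸ XY.*ₚ risingTerm U U-order n j) l m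
      ≡⟨ sym (XY.Σ∞-*ˡ eˣ⁺ʸ (risingTerm U U-order n) (risingTerm-summable U U-order n) l m) ⟩
    (eˣ⁺ʸ XY.*ₚ risingSum U U-order n) l m ∎
    where
    c : ℕ → ℚ
    c i = ι (i ! ℕ.* (i ℕ.+ n) !)
    term : ∀ i → c i * (ι (stirling2⁺ l i) * ι (stirling2⁺ m i)) * invFact l * invFact m ≡ (eˣ⁺ʸ XY.*ₚ risingTerm U U-order n i) l m
    term i = begin
      c i * (ι (stirling2⁺ l i) * ι (stirling2⁺ m i)) * invFact l * invFact m
        ≡⟨ cong (λ v → v * (ι (stirling2⁺ l i) * ι (stirling2⁺ m i)) * invFact l * invFact m) c≡ ⟩
      ι (rising (suc i) n) * ι (i !) * ι (i !) * (ι (stirling2⁺ l i) * ι (stirling2⁺ m i)) * invFact l * invFact m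
        ≡⟨ solve 7 (λ r f f' s s' a b → r :* f :* f' :* (s :* s') :* a :* b := r :* ((f :* s :* a) :* (f' :* s' :* b))) refl
                   (ι (rising (suc i) n)) (ι (i !)) (ι (i !)) (ι (stirling2⁺ l i)) (ι (stirling2⁺ m i)) (invFact l) (invFact m) ⟩
      ι (rising (suc i) n) * (stirling2⁺EGF i l * stirling2⁺EGF i m)
        ≡⟨ cong₂ (λ u v → ι (rising (suc i) n) * (u * v)) (sym (expm1^*eᵗ≈stirling2⁺EGF i l)) (sym (expm1^*eᵗ≈stirling2⁺EGF i m)) ⟩
      ι (rising (suc i) n) * (expm1^*eᵗ i l * expm1^*eᵗ i m)
        ≡⟨ sym (eˣ⁺ʸ*risingTerm n i l m) ⟩
      (eˣ⁺ʸ XY.*ₚ risingTerm U U-order n i) l m ∎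
      where
      open +-*-Solver using (solve; _:*_; _:=_)
      c≡ : c i ≡ ι (rising (suc i) n) * ι (i !) * ι (i !)
      c≡ = begin
        ι (i ! ℕ.* (i ℕ.+ n) !)                         ≡⟨ cong (λ k → ι (i ! ℕ.* k)) (!-split i n) ⟩
        ι (i ! ℕ.* (i ! ℕ.* rising (suc i) n))          ≡⟨ trans (ι-* (i !) _) (cong (ι (i !) *_) (ι-* (i !) _)) ⟩
        ι (i !) * (ι (i !) * ι (rising (suc i) n))      ≡⟨ solve 2 (λ f r → f :* (f :* r) := r :* f :* f) refl (ι (i !)) (ι (rising (suc i) n)) ⟩
        ι (rising (suc i) n) * ι (i !) * ι (i !)        ∎

  expXY≈eˣ⁺ʸ : expXY ≈₂ eˣ⁺ʸ
  expXY≈eˣ⁺ʸ l m = begin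
    expXY l m                                ≡⟨ *₂≈*ₚ expX≈ expY≈ l m ⟩
    (tensor eᵗ 1ₚ XY.*ₚ tensor 1ₚ eᵗ) l m    ≡⟨ tensor-* eᵗ 1ₚ 1ₚ eᵗ l m ⟩
    tensor (eᵗ *ₚ 1ₚ) (1ₚ *ₚ eᵗ) l m         ≡⟨ tensor-cong (SerR.*-identityʳ eᵗ) (SerR.*-identityˡ eᵗ) l m ⟩
    eˣ⁺ʸ l m                                 ∎
    where
    expX≈ : expX ≈₂ tensor eᵗ 1ₚ
    expX≈ l m = cong (eᵗ l *_) (const₁≈κ 1ℚ m)
    expY≈ : expY ≈₂ tensor 1ₚ eᵗ
    expY≈ l m = cong (_* eᵗ m) (const₁≈κ 1ℚ l)

  denominator≈1-U : expX +₂ expY -₂ expXY ≈₂ XY.1ₚ XY.SerR.- U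
  denominator≈1-U l m = begin
    expX l m + expY l m + - expXY l m
      ≡⟨ cong₂ (λ a b → a + b) (cong₂ _+_ (cong (eᵗ l *_) (const₁≈κ 1ℚ m)) (cong (_* eᵗ m) (const₁≈κ 1ℚ l))) (cong -_ (expXY≈eˣ⁺ʸ l m)) ⟩
    eᵗ l * 1ₚ m + 1ₚ l * eᵗ m + - (eᵗ l * eᵗ m)
      ≡⟨ solve 4 (λ x y a b → x :* b :+ a :* y :+ :- (x :* y) := a :* b :+ :- ((x :+ :- a) :* (y :+ :- b))) refl (eᵗ l) (eᵗ m) (1ₚ l) (1ₚ m) ⟩
    1ₚ l * 1ₚ m + - (expm1 l * expm1 m)
      ≡⟨ cong (_+ - (expm1 l * expm1 m)) (tensor-1 l m) ⟩
    (XY.1ₚ XY.SerR.- U) l m ∎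
    where open +-*-Solver using (solve; _:+_; _:*_; :-_; _:=_)

  denominator : ℕ → PS2
  denominator n = (expX +₂ expY -₂ expXY) ^₂ suc n

  denominator≈[1-U]^ : ∀ n → denominator n ≈₂ (XY.1ₚ XY.SerR.- U) XY.Ser.^ suc n
  denominator≈[1-U]^ n = ^₂≈^ denominator≈1-U (suc n)

  denominator*inv₂ : ∀ n → denominator n XY.*ₚ inv₂ (denominator n) ≈₂ XY.1ₚ
  denominator*inv₂ n = XY.SerR.trans (XY.SerR.sym (*₂≈*ₚ {D} {D} {inv₂ D} {inv₂ D} (λ _ _ → refl) (λ _ _ → refl)))
                                     (XY.SerR.trans (*₂-inv₂ D (trans (denominator≈[1-U]^ n 0 0) (1-U^-00 (suc n)))) const₂≈1)
    where
    D : PS2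
    D = denominator n
    1-U^-00 : ∀ r → ((XY.1ₚ XY.SerR.- U) XY.Ser.^ r) 0 0 ≡ 1ℚ
    1-U^-00 zero    = refl
    1-U^-00 (suc r) = trans (cong ((XY.1ₚ XY.SerR.- U) 0 0 *_) (1-U^-00 r)) (ℚP.*-identityʳ ((XY.1ₚ XY.SerR.- U) 0 0))

  lhsExp*denominator : ∀ n → lhsExp n XY.*ₚ denominator n ≈₂ XY.κ (κ (ι (n !))) XY.*ₚ eˣ⁺ʸ
  lhsExp*denominator n = XY.SerReasoning.begin
    lhsExp n XY.*ₚ denominator n
      XY.SerReasoning.≈⟨ XY.*ₚ-cong (lhsExp≈eˣ⁺ʸ*risingSum n) (denominator≈[1-U]^ n) ⟩
    (eˣ⁺ʸ XY.*ₚ risingSum U U-order n) XY.*ₚ (XY.1ₚ XY.SerR.- U) XY.Ser.^ suc n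
      XY.SerReasoning.≈⟨ XY.SerR.*-assoc eˣ⁺ʸ (risingSum U U-order n) ((XY.1ₚ XY.SerR.- U) XY.Ser.^ suc n) ⟩
    eˣ⁺ʸ XY.*ₚ (risingSum U U-order n XY.*ₚ (XY.1ₚ XY.SerR.- U) XY.Ser.^ suc n)
      XY.SerReasoning.≈⟨ XY.*ₚ-congˡ eˣ⁺ʸ (risingSum*[1-u]^suc U U-order n) ⟩
    eˣ⁺ʸ XY.*ₚ XY.κ (Ser.fromℕ (n !))
      XY.SerReasoning.≈⟨ XY.SerR.*-comm eˣ⁺ʸ (XY.κ (Ser.fromℕ (n !))) ⟩
    XY.κ (Ser.fromℕ (n !)) XY.*ₚ eˣ⁺ʸ
      XY.SerReasoning.≈⟨ XY.*ₚ-congʳ eˣ⁺ʸ (XY.κ-cong (Ser-fromℕ≈κι (n !))) ⟩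
    XY.κ (κ (ι (n !))) XY.*ₚ eˣ⁺ʸ XY.SerReasoning.∎

  exponentialGF : ∀ n l m → lhsExp n l m ≡ rhsExp n l m
  exponentialGF n = XY.SerReasoning.begin
    L                          XY.SerReasoning.≈⟨ XY.SerR.sym (XY.SerR.*-identityʳ L) ⟩
    L XY.*ₚ XY.1ₚ              XY.SerReasoning.≈⟨ XY.*ₚ-congˡ L (XY.SerR.sym (denominator*inv₂ n)) ⟩
    L XY.*ₚ (D XY.*ₚ inv₂ D)   XY.SerReasoning.≈⟨ XY.SerR.sym (XY.SerR.*-assoc L D (inv₂ D)) ⟩
    (L XY.*ₚ D) XY.*ₚ inv₂ D   XY.SerReasoning.≈⟨ XY.*ₚ-congʳ (inv₂ D) (lhsExp*denominator n) ⟩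
    (XY.κ (κ (ι (n !))) XY.*ₚ eˣ⁺ʸ) XY.*ₚ inv₂ D
      XY.SerReasoning.≈⟨ XY.SerR.sym (*₂≈*ₚ {ι (n !) ·₂ expXY} {G = inv₂ D} (·₂≈κ*ₚ (ι (n !)) expXY≈eˣ⁺ʸ) (λ _ _ → refl)) ⟩
    rhsExp n                   XY.SerReasoning.∎
    where
    L D : PS2
    L = lhsExp n
    D = denominator n

theorem2p1 : (n : ℕ) →
    ((l m : ℕ) → lhsExp n l m ≡ rhsExp n l m) × ((l m : ℕ) → lhsOrd n l m ≡ rhsOrd n l m)
theorem2p1 n = ExponentialGF.exponentialGF n , OrdinaryGF.ordinaryGF n
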